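{- The closure in $\mathbb{R}$ of the set of rational bichromatic roots is $\mathbb{Z}$.
   Context: All graphs are finite and simple. A $2$-edge-coloured graph is a triple $G=(\Gamma,R,B)$ with $R,B\subseteq E(\Gamma)$, $R\cap B=\emptyset$, $R\cup B=E(\Gamma)$ (red and blue edges); it is bichromatic if $R\ne\emptyset$ and $B\ne\emptyset$. A $k$-colouring of $G$ is a proper vertex colouring $c:V(\Gamma)\to\{1,\dots,k\}$ of $\Gamma$ such that for every $ux\in R$ and $vy\in B$ (either endpoint may play the role of $u$, resp. $v$), $c(u)=c(v)$ implies $c(x)\ne c(y)$. $P(G,\lambda)$ is the polynomial whose value at each non-negative integer $k$ is the number of $k$-colourings of $G$. A bichromatic root is a complex number that is a root of $P(G,\lambda)$ for some bichromatic $2$-edge-coloured graph $G$. -}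

module Defs where

open import Data.Nat as ℕ using (ℕ; zero; suc)
open import Data.Integer as ℤ using (ℤ; +_)
open import Data.Rational using (ℚ; _/_; 0ℚ; _+_; _*_)
open import Data.Fin using (Fin; _≟_)
open import Data.Vec using (Vec; []; _∷_; lookup)
open import Data.List using (List; []; _∷_; [_]; allFin; concatMap; map; all; filterᵇ; length)
open import Data.Bool using (Bool; true; false; _∧_; _∨_; not)
open import Data.Product using (Σ; ∃; _×_; _,_)
open import Relation.Nullary.Decidable using (⌊_⌋)
open import Relation.Binary.PropositionalEquality using (_≡_)

data EdgeC : Set where
  none red blue : EdgeC

-- R = pairs with status red,
-- B = pairs with status blue, so R ∩ B = ∅ and R ∪ B = E(Γ).
record TwoEdgeColouredGraph (n : ℕ) : Set where
  field
    edge    : Fin n → Fin n → EdgeC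
    symm    : ∀ u v → edge u v ≡ edge v u
    loopless : ∀ u → edge u u ≡ none
open TwoEdgeColouredGraph public

Bichromatic : ∀ {n} → TwoEdgeColouredGraph n → Set
Bichromatic G = (∃ λ u → ∃ λ v → edge G u v ≡ red) × (∃ λ u → ∃ λ v → edge G u v ≡ blue)

isRed isBlue isEdge : EdgeC → Bool
isRed red = true
isRed _ = false
isBlue blue = true
isBlue _ = false
isEdge none = false
isEdge _ = true

_==_ : ∀ {k} → Fin k → Fin k → Bool
a == b = ⌊ a ≟ b ⌋

-- c : Fin n → Fin k (given as a vector) is a k-colouring of G:
-- proper, and for every red edge ux and blue edge vy (ordered pairs, so either
-- endpoint may play the role of u, resp. v), c u = c v implies c x ≠ c y.
isColouring : ∀ {n k} → TwoEdgeColouredGraph n → Vec (Fin k) n → Bool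
isColouring {n} G c =
  all (λ u → all (λ v → not (isEdge (edge G u v)) ∨ not (col u == col v)) (allFin n)) (allFin n)
  ∧ all (λ u → all (λ x → all (λ v → all (λ y →
        not (isRed (edge G u x) ∧ isBlue (edge G v y) ∧ (col u == col v) ∧ (col x == col y)))
      (allFin n)) (allFin n)) (allFin n)) (allFin n)
  where col = lookup c

allMaps : ∀ n k → List (Vec (Fin k) n)
allMaps zero k = [ [] ]
allMaps (suc n) k = concatMap (λ i → map (i ∷_) (allMaps n k)) (allFin k)

numColourings : ∀ {n} → TwoEdgeColouredGraph n → ℕ → ℕ
numColourings {n} G k = length (filterᵇ (isColouring G) (allMaps n k))

-- Rational polynomials as coefficient lists (constant term first), Horner evaluation.
evalPoly : List ℚ → ℚ → ℚ
evalPoly [] x = 0ℚ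
evalPoly (a ∷ as) x = a + x * evalPoly as x

ℕtoℚ : ℕ → ℚ
ℕtoℚ k = + k / 1

ℤtoℚ : ℤ → ℚ
ℤtoℚ z = z / 1

IsChromaticPoly : ∀ {n} → TwoEdgeColouredGraph n → List ℚ → Set
IsChromaticPoly G p = ∀ k → evalPoly p (ℕtoℚ k) ≡ ℕtoℚ (numColourings G k)

RationalBichromaticRoot : ℚ → Set
RationalBichromaticRoot q =
  Σ ℕ λ n → Σ (TwoEdgeColouredGraph n) λ G → Bichromatic G ×
    Σ (List ℚ) λ p → IsChromaticPoly G p × evalPoly p q ≡ 0ℚ

-- Grouping the k-colourings of G by the partition of its vertex set into colour classes gives
-- P(G, k) = Σ_π k(k-1)⋯(k-|π|+1), summed over the partitions π whose blocks may receive pairwise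
-- distinct colours. The discrete partition always qualifies and all others have fewer than n
-- blocks, so P(G, λ) is monic of degree n with integer coefficients; writing a rational root as a/b
-- in lowest terms then gives b ∣ aⁿ, hence b = 1. A polynomial is determined by its values on ℕ,
-- so this applies to every p representing P(G, λ), bichromatic or not.
-- Conversely, for a red edge next to a blue m-clique a colouring is an injective colouring of the
-- clique plus two distinct colours for the edge that are not both used on the clique, so
-- P = λ(λ-1)⋯(λ-m+1)·(λ-m)(λ+m-1), which vanishes at 0, …, m and at 1-m; m = t+2 covers t and -(1+t).

module Submission where

open import Defs
open import Data.Bool using (Bool; true; false; _∧_; _∨_; not; if_then_else_)
open import Data.Bool.ListAction using (all)
open import Data.Bool.Properties using (∧-zeroʳ; if-∧; if-swap-then; if-float; if-cong-then)
open import Data.Empty using (⊥; ⊥-elim)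
open import Data.Fin using (Fin; zero; suc; _≟_)
open import Data.Fin.Properties using (suc-injective)
open import Data.Integer as ℤ using (ℤ; 0ℤ; 1ℤ)
import Data.Integer.Properties as ℤ
import Data.Integer.Tactic.RingSolver as ℤ-Solver
open import Data.List using (List; []; _∷_; _++_; map; concatMap; filterᵇ; length; allFin; tabulate)
open import Data.List.Membership.Propositional.Properties using (∈-allFin)
open import Data.List.Properties using (map-tabulate; length-tabulate; length-map)
open import Data.List.Relation.Unary.All as All using (All; []; _∷_)
import Data.List.Relation.Unary.All.Properties as All
open import Data.Nat as ℕ using (ℕ; zero; suc; _+_; _*_; _∸_; _≤_; _<_)
open import Data.Nat.Combinatorics.Base using (_P′_)
open import Data.Nat.Coprimality as Coprime using (Coprime)
open import Data.Nat.Divisibility using (_∣_; divides; ∣1⇒≡1)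
import Data.Nat.Properties as ℕ
open import Data.Product using (Σ; ∃; _×_; _,_; proj₁; proj₂)
open import Data.Rational as ℚ using (ℚ; mkℚ; 0ℚ; 1ℚ; ↥_; ↧ₙ_)
import Data.Rational.Properties as ℚ
import Data.Rational.Unnormalised as ℚᵘ
import Data.Rational.Unnormalised.Properties as ℚᵘ
open import Data.Sum using (_⊎_; inj₁; inj₂; [_,_]′)
open import Data.Vec as Vec using (Vec; []; _∷_; lookup)
open import Data.Vec.Properties using (lookup∘tabulate)
open import Function using (_∘_; id; case_of_)
open import Level using (0ℓ)
open import Relation.Binary.PropositionalEquality
open import Relation.Nullary using (yes; no)
open import Relation.Nullary.Decidable.Core using (dec⇒maybe)
open import Tactic.RingSolver using (solve-∀)
open import Tactic.RingSolver.Core.AlmostCommutativeRing using (AlmostCommutativeRing; fromCommutativeRing)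

open import Algebra.Properties.CommutativeSemigroup ℕ.+-commutativeSemigroup
  using () renaming (interchange to +-interchange)
open ≡-Reasoning

private variable
  A B : Set
  n k d : ℕ

-- Finite sums

∑ : List A → (A → ℕ) → ℕ
∑ []       f = 0
∑ (x ∷ xs) f = f x + ∑ xs f

syntax ∑ xs (λ x → e) = ∑[ x ← xs ] e

ind : Bool → ℕ → ℕ
ind b m = if b then m else 0

∑-cong : (xs : List A) {f g : A → ℕ} → (∀ x → f x ≡ g x) → ∑ xs f ≡ ∑ xs g
∑-cong []       f≗g = refl
∑-cong (x ∷ xs) f≗g = cong₂ _+_ (f≗g x) (∑-cong xs f≗g)

∑-cong-All : {xs : List A} {f g : A → ℕ} → All (λ x → f x ≡ g x) xs → ∑ xs f ≡ ∑ xs g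
∑-cong-All []         = refl
∑-cong-All (fx≡gx ∷ eqs) = cong₂ _+_ fx≡gx (∑-cong-All eqs)

∑-++ : (xs ys : List A) (f : A → ℕ) → ∑ (xs ++ ys) f ≡ ∑ xs f + ∑ ys f
∑-++ []       ys f = refl
∑-++ (x ∷ xs) ys f = trans (cong (f x +_) (∑-++ xs ys f)) (sym (ℕ.+-assoc (f x) _ _))

∑-map : (xs : List A) (h : A → B) (f : B → ℕ) → ∑ (map h xs) f ≡ ∑ xs (f ∘ h)
∑-map []       h f = refl
∑-map (x ∷ xs) h f = cong (f (h x) +_) (∑-map xs h f)

∑-concatMap : (xs : List A) (g : A → List B) (f : B → ℕ) →
              ∑ (concatMap g xs) f ≡ ∑[ x ← xs ] ∑ (g x) f
∑-concatMap []       g f = refl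
∑-concatMap (x ∷ xs) g f =
  trans (∑-++ (g x) (concatMap g xs) f) (cong (∑ (g x) f +_) (∑-concatMap xs g f))

∑-distrib-+ : (xs : List A) (f g : A → ℕ) → ∑[ x ← xs ] (f x + g x) ≡ ∑ xs f + ∑ xs g
∑-distrib-+ []       f g = refl
∑-distrib-+ (x ∷ xs) f g =
  trans (cong ((f x + g x) +_) (∑-distrib-+ xs f g)) (+-interchange (f x) (g x) (∑ xs f) (∑ xs g))

∑-zero : (xs : List A) → ∑[ x ← xs ] 0 ≡ 0
∑-zero []       = refl
∑-zero (x ∷ xs) = ∑-zero xs

∑-distribʳ-* : (xs : List A) (f : A → ℕ) (c : ℕ) → ∑[ x ← xs ] (f x * c) ≡ ∑ xs f * c
∑-distribʳ-* []       f c = refl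
∑-distribʳ-* (x ∷ xs) f c =
  trans (cong (f x * c +_) (∑-distribʳ-* xs f c)) (sym (ℕ.*-distribʳ-+ c (f x) (∑ xs f)))

∑-const : (xs : List A) (c : ℕ) → ∑[ x ← xs ] c ≡ length xs * c
∑-const []       c = refl
∑-const (x ∷ xs) c = cong (c +_) (∑-const xs c)

∑-comm : (xs : List A) (ys : List B) (f : A → B → ℕ) →
         ∑[ x ← xs ] ∑ ys (f x) ≡ ∑[ y ← ys ] ∑[ x ← xs ] f x y
∑-comm []       ys f = sym (∑-zero ys)
∑-comm (x ∷ xs) ys f =
  trans (cong (∑ ys (f x) +_) (∑-comm xs ys f)) (sym (∑-distrib-+ ys (f x) _))

∑-ind : (xs : List A) (b : Bool) (f : A → ℕ) → ∑[ x ← xs ] ind b (f x) ≡ ind b (∑ xs f)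
∑-ind xs true  f = refl
∑-ind xs false f = ∑-zero xs

∑-filterᵇ : (p : A → Bool) (xs : List A) (f : A → ℕ) →
            ∑ (filterᵇ p xs) f ≡ ∑[ x ← xs ] ind (p x) (f x)
∑-filterᵇ p []       f = refl
∑-filterᵇ p (x ∷ xs) f with p x
... | true  = cong (f x +_) (∑-filterᵇ p xs f)
... | false = ∑-filterᵇ p xs f

length≡∑1 : (xs : List A) → length xs ≡ ∑[ x ← xs ] 1
length≡∑1 []       = refl
length≡∑1 (x ∷ xs) = cong suc (length≡∑1 xs)

∑-allFin-suc : (f : Fin (suc n) → ℕ) → ∑ (allFin (suc n)) f ≡ f zero + ∑ (allFin n) (f ∘ suc)
∑-allFin-suc {n} f =
  cong (f zero +_) (trans (cong (λ xs → ∑ xs f) (sym (map-tabulate id suc))) (∑-map (allFin n) suc f))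

∑-allFin-1 : ∀ k → ∑[ i ← allFin k ] 1 ≡ k
∑-allFin-1 k = trans (sym (length≡∑1 (allFin k))) (length-tabulate id)

bool-ext : {a b : Bool} → (a ≡ true → b ≡ true) → (b ≡ true → a ≡ true) → a ≡ b
bool-ext {false} {false} _ _ = refl
bool-ext {false} {true}  _ g = g refl
bool-ext {true}  {false} f _ = sym (f refl)
bool-ext {true}  {true}  _ _ = refl

∧≡true⁻ : {a b : Bool} → (a ∧ b) ≡ true → a ≡ true × b ≡ true
∧≡true⁻ {true} b≡true = refl , b≡true

≡⇒== : {i j : Fin k} → i ≡ j → (i == j) ≡ true
≡⇒== {i = i} {j} i≡j with i ≟ j
... | yes _   = refl
... | no  i≢j = ⊥-elim (i≢j i≡j)

≢⇒== : {i j : Fin k} → i ≢ j → (i == j) ≡ false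
≢⇒== {i = i} {j} i≢j with i ≟ j
... | yes i≡j = ⊥-elim (i≢j i≡j)
... | no  _   = refl

==-refl : (i : Fin k) → (i == i) ≡ true
==-refl i = ≡⇒== refl

==⇒≡ : {i j : Fin k} → (i == j) ≡ true → i ≡ j
==⇒≡ {i = i} {j} i==j with i ≟ j | i==j
... | yes i≡j | _  = i≡j
... | no  _   | ()

==-sym : (i j : Fin k) → (i == j) ≡ (j == i)
==-sym i j = bool-ext (≡⇒== ∘ sym ∘ ==⇒≡) (≡⇒== ∘ sym ∘ ==⇒≡)

==-suc : (i j : Fin k) → (suc i == suc j) ≡ (i == j)
==-suc i j = bool-ext (≡⇒== ∘ suc-injective ∘ ==⇒≡) (≡⇒== ∘ cong suc ∘ ==⇒≡)

∑-allFin-δ : (j : Fin k) (H : Fin k → ℕ) → ∑[ i ← allFin k ] ind (i == j) (H i) ≡ H j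
∑-allFin-δ {suc k} zero H = begin
  ∑[ i ← allFin (suc k) ] ind (i == zero) (H i)  ≡⟨ ∑-allFin-suc (λ i → ind (i == zero) (H i)) ⟩
  ind (zero {k} == zero) (H zero) + ∑[ i ← allFin k ] ind (suc i == zero) (H (suc i))
    ≡⟨ cong₂ _+_ (cong (λ b → ind b (H zero)) (==-refl {suc k} zero))
                 (∑-cong (allFin k) (λ i → cong (λ b → ind b (H (suc i))) (≢⇒== {i = suc i} {zero} λ ()))) ⟩
  H zero + ∑[ i ← allFin k ] 0                           ≡⟨ cong (H zero +_) (∑-zero (allFin k)) ⟩
  H zero + 0                                             ≡⟨ ℕ.+-identityʳ (H zero) ⟩
  H zero                                                 ∎
∑-allFin-δ {suc k} (suc j) H = begin
  ∑[ i ← allFin (suc k) ] ind (i == suc j) (H i)  ≡⟨ ∑-allFin-suc (λ i → ind (i == suc j) (H i)) ⟩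
  ind (zero == suc j) (H zero) + ∑[ i ← allFin k ] ind (suc i == suc j) (H (suc i))
    ≡⟨ cong₂ _+_ (cong (λ b → ind b (H zero)) (≢⇒== {i = zero} {suc j} λ ()))
                 (∑-cong (allFin k) (λ i → cong (λ b → ind b (H (suc i))) (==-suc i j))) ⟩
  ∑[ i ← allFin k ] ind (i == j) (H (suc i))             ≡⟨ ∑-allFin-δ j (H ∘ suc) ⟩
  H (suc j)                                              ∎

-- Injections

fresh : Vec (Fin k) d → Fin k → Bool
fresh []      i = true
fresh (j ∷ ι) i = not (i == j) ∧ fresh ι i

distinct : Vec (Fin k) d → Bool
distinct []      = true
distinct (j ∷ ι) = fresh ι j ∧ distinct ι

fresh⇒≢lookup : (ι : Vec (Fin k) d) {i : Fin k} → fresh ι i ≡ true → ∀ b → i ≢ lookup ι b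
fresh⇒≢lookup (j ∷ ι) {i} fresh-i zero    refl with () ← trans (sym fresh-i) (cong (λ b → not b ∧ fresh ι i) (==-refl i))
fresh⇒≢lookup (j ∷ ι) {i} fresh-i (suc b) = fresh⇒≢lookup ι (proj₂ (∧≡true⁻ {not (i == j)} fresh-i)) b

fresh-lookup : (ι : Vec (Fin k) d) (b : Fin d) → fresh ι (lookup ι b) ≡ false
fresh-lookup ι b with fresh ι (lookup ι b) in fresh-ιb
... | true  = ⊥-elim (fresh⇒≢lookup ι fresh-ιb b refl)
... | false = refl

fresh-false⇒occurs : (ι : Vec (Fin k) d) {i : Fin k} → fresh ι i ≡ false → ∃ λ b → i ≡ lookup ι b
fresh-false⇒occurs (j ∷ ι) {i} stale with i == j in i==j
... | true  = zero , ==⇒≡ i==j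
... | false = let b , i≡ιb = fresh-false⇒occurs ι stale in suc b , i≡ιb

lookup-injective : (ι : Vec (Fin k) d) → distinct ι ≡ true → ∀ a b → lookup ι a ≡ lookup ι b → a ≡ b
lookup-injective (j ∷ ι) dist zero    zero    _ = refl
lookup-injective (j ∷ ι) dist zero    (suc b) e = ⊥-elim (fresh⇒≢lookup ι (proj₁ (∧≡true⁻ dist)) b e)
lookup-injective (j ∷ ι) dist (suc a) zero    e = ⊥-elim (fresh⇒≢lookup ι (proj₁ (∧≡true⁻ dist)) a (sym e))
lookup-injective (j ∷ ι) dist (suc a) (suc b) e = cong suc (lookup-injective ι (proj₂ (∧≡true⁻ dist)) a b e)

injective⇒distinct : (ι : Vec (Fin k) d) → (∀ a b → lookup ι a ≡ lookup ι b → a ≡ b) → distinct ι ≡ true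
injective⇒distinct []      _   = refl
injective⇒distinct (j ∷ ι) inj = cong₂ _∧_ fresh-j (injective⇒distinct ι (λ a b → suc-injective ∘ inj (suc a) (suc b)))
  where
  fresh-j : fresh ι j ≡ true
  fresh-j with fresh ι j in fresh-ιj
  ... | true  = refl
  ... | false with () ← inj zero (suc (proj₁ (fresh-false⇒occurs ι fresh-ιj))) (proj₂ (fresh-false⇒occurs ι fresh-ιj))

∑-allFin-split : (ι : Vec (Fin k) d) → distinct ι ≡ true → (H : Fin k → ℕ) →
                 ∑ (allFin k) H ≡ ∑[ i ← allFin k ] ind (fresh ι i) (H i) + ∑[ b ← allFin d ] H (lookup ι b)
∑-allFin-split []          _    H = sym (ℕ.+-identityʳ _)
∑-allFin-split {k} (j ∷ ι) dist H = begin
  ∑ (allFin k) H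
    ≡⟨ ∑-allFin-split ι dist-ι H ⟩
  ∑[ i ← allFin k ] ind (fresh ι i) (H i) + ∑ (allFin _) (H ∘ lookup ι)
    ≡⟨ cong (_+ ∑ (allFin _) (H ∘ lookup ι)) (trans (∑-cong (allFin k) split-j) (∑-distrib-+ (allFin k) _ _)) ⟩
  (Fresh + ∑[ i ← allFin k ] ind (i == j) (H i)) + ∑ (allFin _) (H ∘ lookup ι)
    ≡⟨ cong (λ z → (Fresh + z) + ∑ (allFin _) (H ∘ lookup ι)) (∑-allFin-δ j H) ⟩
  (Fresh + H j) + ∑ (allFin _) (H ∘ lookup ι)
    ≡⟨ ℕ.+-assoc Fresh (H j) _ ⟩
  Fresh + (H j + ∑ (allFin _) (H ∘ lookup ι))
    ≡⟨ cong (Fresh +_) (∑-allFin-suc (H ∘ lookup (j ∷ ι))) ⟨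
  Fresh + ∑ (allFin (suc _)) (H ∘ lookup (j ∷ ι))
    ∎
  where
  fresh-j : fresh ι j ≡ true
  fresh-j = proj₁ (∧≡true⁻ dist)
  dist-ι : distinct ι ≡ true
  dist-ι = proj₂ (∧≡true⁻ dist)
  Fresh : ℕ
  Fresh = ∑[ i ← allFin k ] ind (fresh (j ∷ ι) i) (H i)
  split-j : ∀ i → ind (fresh ι i) (H i) ≡ ind (fresh (j ∷ ι) i) (H i) + ind (i == j) (H i)
  split-j i with i == j in i==j | fresh ι i in fresh-i
  ... | true  | true  = refl
  ... | true  | false with () ← trans (sym fresh-i) (subst (λ x → fresh ι x ≡ true) (sym (==⇒≡ i==j)) fresh-j)
  ... | false | true  = sym (ℕ.+-identityʳ _)
  ... | false | false = refl

count-fresh : (ι : Vec (Fin k) d) → distinct ι ≡ true → ∑[ i ← allFin k ] ind (fresh ι i) 1 ≡ k ∸ d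
count-fresh {k} {d} ι dist = begin
  Fresh                                   ≡⟨ ℕ.m+n∸n≡m Fresh d ⟨
  Fresh + d ∸ d                           ≡⟨ cong (λ z → Fresh + z ∸ d) (∑-allFin-1 d) ⟨
  Fresh + ∑[ b ← allFin d ] 1 ∸ d         ≡⟨ cong (_∸ d) (∑-allFin-split ι dist (λ _ → 1)) ⟨
  ∑[ i ← allFin k ] 1 ∸ d                 ≡⟨ cong (_∸ d) (∑-allFin-1 k) ⟩
  k ∸ d                                   ∎
  where
  Fresh : ℕ
  Fresh = ∑[ i ← allFin k ] ind (fresh ι i) 1

count-pairs-not-both-in : (v : Vec (Fin k) d) → distinct v ≡ true →
  ∑[ i ← allFin k ] ∑[ j ← allFin k ] ind (not (i == j) ∧ (fresh v i ∨ fresh v j)) 1 ≡ (k ∸ d) * (k ∸ 1) + d * (k ∸ d)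
count-pairs-not-both-in {k} {d} v dist = begin
  ∑ (allFin k) Pairs
    ≡⟨ ∑-allFin-split v dist Pairs ⟩
  ∑[ i ← allFin k ] ind (fresh v i) (Pairs i) + ∑[ b ← allFin d ] Pairs (lookup v b)
    ≡⟨ cong₂ _+_ (∑-cong (allFin k) from-fresh) (∑-cong (allFin d) from-occurring) ⟩
  ∑[ i ← allFin k ] (ind (fresh v i) 1 * (k ∸ 1)) + ∑[ b ← allFin d ] (k ∸ d)
    ≡⟨ cong₂ _+_ (∑-distribʳ-* (allFin k) (λ i → ind (fresh v i) 1) (k ∸ 1)) (∑-const (allFin d) (k ∸ d)) ⟩
  (∑[ i ← allFin k ] ind (fresh v i) 1) * (k ∸ 1) + length (allFin d) * (k ∸ d)
    ≡⟨ cong₂ (λ x y → x * (k ∸ 1) + y * (k ∸ d)) (count-fresh v dist) (length-tabulate {n = d} id) ⟩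
  (k ∸ d) * (k ∸ 1) + d * (k ∸ d)
    ∎
  where
  Pairs : Fin k → ℕ
  Pairs i = ∑[ j ← allFin k ] ind (not (i == j) ∧ (fresh v i ∨ fresh v j)) 1
  from-fresh : ∀ i → ind (fresh v i) (Pairs i) ≡ ind (fresh v i) 1 * (k ∸ 1)
  from-fresh i with fresh v i
  ... | false = refl
  ... | true  = begin
    ∑[ j ← allFin k ] ind (not (i == j) ∧ true) 1
      ≡⟨ ∑-cong (allFin k) (λ j → cong (λ b → ind (not b ∧ true) 1) (==-sym i j)) ⟩
    ∑[ j ← allFin k ] ind (fresh (i ∷ []) j) 1      ≡⟨ count-fresh (i ∷ []) refl ⟩
    k ∸ 1                                          ≡⟨ ℕ.*-identityˡ (k ∸ 1) ⟨
    1 * (k ∸ 1)                                    ∎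
  from-occurring : ∀ b → Pairs (lookup v b) ≡ k ∸ d
  from-occurring b = trans (∑-cong (allFin k) only-fresh) (count-fresh v dist)
    where
    only-fresh : ∀ j → ind (not (lookup v b == j) ∧ (fresh v (lookup v b) ∨ fresh v j)) 1 ≡ ind (fresh v j) 1
    only-fresh j rewrite fresh-lookup v b with fresh v j in fresh-j
    ... | false = cong (λ b → ind b 1) (∧-zeroʳ _)
    ... | true  = cong (λ b → ind (not b ∧ true) 1) (≢⇒== (fresh⇒≢lookup v fresh-j b ∘ sym))

all-filterᵇ : (p : A → Bool) (xs : List A) → All (λ x → p x ≡ true) (filterᵇ p xs)
all-filterᵇ p []       = []
all-filterᵇ p (x ∷ xs) with p x in px
... | true  = px ∷ all-filterᵇ p xs
... | false = all-filterᵇ p xs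

∑-allMaps-suc : (F : Vec (Fin k) (suc n) → ℕ) →
                ∑ (allMaps (suc n) k) F ≡ ∑[ i ← allFin k ] ∑[ v ← allMaps n k ] F (i ∷ v)
∑-allMaps-suc {k} {n} F = trans (∑-concatMap (allFin k) (λ i → map (i ∷_) (allMaps n k)) F)
                                (∑-cong (allFin k) (λ i → ∑-map (allMaps n k) (i ∷_) F))

injections : ∀ d k → List (Vec (Fin k) d)
injections d k = filterᵇ distinct (allMaps d k)

injections-distinct : ∀ d k → All (λ ι → distinct ι ≡ true) (injections d k)
injections-distinct d k = all-filterᵇ distinct (allMaps d k)

∑-injections-suc : (F : Vec (Fin k) (suc d) → ℕ) →
  ∑ (injections (suc d) k) F ≡ ∑[ ι ← injections d k ] ∑[ i ← allFin k ] ind (fresh ι i) (F (i ∷ ι))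
∑-injections-suc {k} {d} F = begin
  ∑ (injections (suc d) k) F
    ≡⟨ ∑-filterᵇ distinct (allMaps (suc d) k) F ⟩
  ∑[ c ← allMaps (suc d) k ] ind (distinct c) (F c)
    ≡⟨ ∑-allMaps-suc (λ c → ind (distinct c) (F c)) ⟩
  ∑[ i ← allFin k ] ∑[ ι ← allMaps d k ] ind (fresh ι i ∧ distinct ι) (F (i ∷ ι))
    ≡⟨ ∑-comm (allFin k) (allMaps d k) _ ⟩
  ∑[ ι ← allMaps d k ] ∑[ i ← allFin k ] ind (fresh ι i ∧ distinct ι) (F (i ∷ ι))
    ≡⟨ ∑-cong (allMaps d k) (λ ι → trans (∑-cong (allFin k) λ i →
                                             trans (if-∧ (fresh ι i)) (if-swap-then (fresh ι i) (distinct ι)))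
                                         (∑-ind (allFin k) (distinct ι) _)) ⟩
  ∑[ ι ← allMaps d k ] ind (distinct ι) (∑[ i ← allFin k ] ind (fresh ι i) (F (i ∷ ι)))
    ≡⟨ ∑-filterᵇ distinct (allMaps d k) _ ⟨
  ∑[ ι ← injections d k ] ∑[ i ← allFin k ] ind (fresh ι i) (F (i ∷ ι))
    ∎

length-injections : ∀ d k → length (injections d k) ≡ k P′ d
length-injections zero    k = refl
length-injections (suc d) k = begin
  length (injections (suc d) k)                               ≡⟨ length≡∑1 (injections (suc d) k) ⟩
  ∑[ ι ← injections (suc d) k ] 1                            ≡⟨ ∑-injections-suc {k} {d} (λ _ → 1) ⟩
  ∑[ ι ← injections d k ] ∑[ i ← allFin k ] ind (fresh ι i) 1
    ≡⟨ ∑-cong-All (All.map (λ {ι} → count-fresh ι) (injections-distinct d k)) ⟩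
  ∑[ ι ← injections d k ] (k ∸ d)                            ≡⟨ ∑-const (injections d k) (k ∸ d) ⟩
  length (injections d k) * (k ∸ d)                           ≡⟨ cong (_* (k ∸ d)) (length-injections d k) ⟩
  (k P′ d) * (k ∸ d)                                          ≡⟨ ℕ.*-comm (k P′ d) (k ∸ d) ⟩
  k P′ suc d                                               ∎

-- Counting colourings by set partitions

data Partition : ℕ → ℕ → Set where
  ∅    : Partition 0 0
  join : Fin d → Partition n d → Partition (suc n) d
  new  : Partition n d → Partition (suc n) (suc d)

blockOf : Partition n d → Fin n → Fin d
blockOf (join b P) zero    = b
blockOf (join b P) (suc u) = blockOf P u
blockOf (new P)    zero    = zero
blockOf (new P)    (suc u) = suc (blockOf P u)

blockColouring : Partition n d → Vec (Fin k) d → Vec (Fin k) n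
blockColouring P ι = Vec.tabulate (lookup ι ∘ blockOf P)

extensions : Σ ℕ (Partition n) → List (Σ ℕ (Partition (suc n)))
extensions (d , P) = (suc d , new P) ∷ map (λ b → d , join b P) (allFin d)

partitions : ∀ n → List (Σ ℕ (Partition n))
partitions zero    = (0 , ∅) ∷ []
partitions (suc n) = concatMap extensions (partitions n)

-- A colouring is an injective colouring of the blocks of the partition it induces.
∑-allMaps-by-partition : ∀ n k (F : Vec (Fin k) n → ℕ) →
  ∑ (allMaps n k) F ≡ ∑ (partitions n) λ (d , P) → ∑[ ι ← injections d k ] F (blockColouring P ι)
∑-allMaps-by-partition zero    k F = cong (_+ 0) (sym (ℕ.+-identityʳ (F [])))
∑-allMaps-by-partition (suc n) k F = begin
  ∑ (allMaps (suc n) k) F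
    ≡⟨ ∑-allMaps-suc F ⟩
  ∑[ i ← allFin k ] ∑[ v ← allMaps n k ] F (i ∷ v)
    ≡⟨ ∑-comm (allFin k) (allMaps n k) _ ⟩
  ∑[ v ← allMaps n k ] ∑[ i ← allFin k ] F (i ∷ v)
    ≡⟨ ∑-allMaps-by-partition n k _ ⟩
  ∑ (partitions n) (λ (d , P) → ∑[ ι ← injections d k ] ∑[ i ← allFin k ] F (i ∷ blockColouring P ι))
    ≡⟨ ∑-cong (partitions n) extend ⟩
  ∑[ e ← partitions n ] ∑ (extensions e) R
    ≡⟨ ∑-concatMap (partitions n) extensions R ⟨
  ∑ (partitions (suc n)) R
    ∎
  where
  R : Σ ℕ (Partition (suc n)) → ℕ
  R (d , P) = ∑[ ι ← injections d k ] F (blockColouring P ι)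
  extend : ∀ ((d , P) : Σ ℕ (Partition n)) →
           ∑[ ι ← injections d k ] ∑[ i ← allFin k ] F (i ∷ blockColouring P ι) ≡ ∑ (extensions (d , P)) R
  extend (d , P) = begin
    ∑[ ι ← injections d k ] ∑[ i ← allFin k ] F (i ∷ blockColouring P ι)
      ≡⟨ ∑-cong-All (All.map (λ {ι} dist → ∑-allFin-split ι dist _) (injections-distinct d k)) ⟩
    ∑[ ι ← injections d k ] (∑[ i ← allFin k ] ind (fresh ι i) (F (i ∷ blockColouring P ι))
                             + ∑[ b ← allFin d ] F (lookup ι b ∷ blockColouring P ι))
      ≡⟨ ∑-distrib-+ (injections d k) _ _ ⟩
    ∑[ ι ← injections d k ] ∑[ i ← allFin k ] ind (fresh ι i) (F (i ∷ blockColouring P ι))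
      + ∑[ ι ← injections d k ] ∑[ b ← allFin d ] F (lookup ι b ∷ blockColouring P ι)
      ≡⟨ cong₂ _+_ (sym (∑-injections-suc (F ∘ blockColouring (new P))))
                   (trans (∑-comm (injections d k) (allFin d) _) (sym (∑-map (allFin d) (λ b → d , join b P) R))) ⟩
    R (suc d , new P) + ∑ (map (λ b → d , join b P) (allFin d)) R
      ∎

discrete : ∀ n → Partition n n
discrete zero    = ∅
discrete (suc n) = new (discrete n)

blockOf-discrete : ∀ n (u : Fin n) → blockOf (discrete n) u ≡ u
blockOf-discrete (suc n) zero    = refl
blockOf-discrete (suc n) (suc u) = cong suc (blockOf-discrete n u)

nonDiscrete : ∀ n → List (Σ ℕ (Partition n))
nonDiscrete zero    = []
nonDiscrete (suc n) = map (λ b → n , join b (discrete n)) (allFin n) ++ concatMap extensions (nonDiscrete n)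

partitions≡discrete∷nonDiscrete : ∀ n → partitions n ≡ (n , discrete n) ∷ nonDiscrete n
partitions≡discrete∷nonDiscrete zero    = refl
partitions≡discrete∷nonDiscrete (suc n) rewrite partitions≡discrete∷nonDiscrete n = refl

nonDiscrete-fewer-blocks : ∀ n → All (λ (d , _) → d < n) (nonDiscrete n)
nonDiscrete-fewer-blocks zero    = []
nonDiscrete-fewer-blocks (suc n) = All.++⁺
  (All.map⁺ (All.tabulate⁺ λ _ → ℕ.n<1+n n))
  (All.concat⁺ (All.map⁺ (All.map extensions-fewer (nonDiscrete-fewer-blocks n))))
  where
  extensions-fewer : ∀ {(d , P) : Σ ℕ (Partition n)} → d < n → All (λ (d′ , _) → d′ < suc n) (extensions (d , P))
  extensions-fewer d<n = ℕ.s≤s d<n ∷ All.map⁺ (All.tabulate⁺ λ _ → ℕ.m<n⇒m<1+n d<n)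

record IsColouring (G : TwoEdgeColouredGraph n) (c : Vec (Fin k) n) : Set where
  field
    proper     : ∀ u v → isEdge (edge G u v) ≡ true → lookup c u ≢ lookup c v
    compatible : ∀ u x v y → edge G u x ≡ red → edge G v y ≡ blue →
                 lookup c u ≡ lookup c v → lookup c x ≢ lookup c y

module _ {p : A → Bool} where
  all≡true⁺ : (xs : List A) → (∀ x → p x ≡ true) → all p xs ≡ true
  all≡true⁺ []       _   = refl
  all≡true⁺ (x ∷ xs) p≡t = cong₂ _∧_ (p≡t x) (all≡true⁺ xs p≡t)

  all≡true⁻ : (xs : List A) → all p xs ≡ true → All (λ x → p x ≡ true) xs
  all≡true⁻ []       _        = []
  all≡true⁻ (x ∷ xs) all≡true = let px , pxs = ∧≡true⁻ all≡true in px ∷ all≡true⁻ xs pxs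

all-allFin⁻ : {p : Fin n → Bool} → all p (allFin n) ≡ true → ∀ i → p i ≡ true
all-allFin⁻ {n} all≡true i = All.lookup (all≡true⁻ (allFin n) all≡true) (∈-allFin i)

module _ (G : TwoEdgeColouredGraph n) (c : Vec (Fin k) n) where
  private
    col : Fin n → Fin k
    col = lookup c

    not-edge-or-distinct : ∀ {a b} → a ≡ true → b ≡ true → (not a ∨ not b) ≡ false
    not-edge-or-distinct refl refl = refl

    not-clash : ∀ {r b e e′} → r ≡ red → b ≡ blue → e ≡ true → e′ ≡ true →
                not (isRed r ∧ isBlue b ∧ e ∧ e′) ≡ false
    not-clash refl refl refl refl = refl

  isColouring⇒IsColouring : isColouring G c ≡ true → IsColouring G c
  isColouring⇒IsColouring valid = record
    { proper     = λ u v uv cu≡cv → true≢false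
        (trans (sym (properᵇ u v)) (not-edge-or-distinct uv (≡⇒== cu≡cv)))
    ; compatible = λ u x v y ux vy cu≡cv cx≡cy → true≢false
        (trans (sym (compatibleᵇ u x v y)) (not-clash ux vy (≡⇒== cu≡cv) (≡⇒== cx≡cy)))
    }
    where
    properᵇ : ∀ u v → (not (isEdge (edge G u v)) ∨ not (col u == col v)) ≡ true
    properᵇ u = all-allFin⁻ (all-allFin⁻ (proj₁ (∧≡true⁻ valid)) u)
    compatibleᵇ : ∀ u x v y →
      not (isRed (edge G u x) ∧ isBlue (edge G v y) ∧ (col u == col v) ∧ (col x == col y)) ≡ true
    compatibleᵇ u x v = all-allFin⁻ (all-allFin⁻ (all-allFin⁻ (all-allFin⁻ (proj₂ (∧≡true⁻ valid)) u) x) v)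
    true≢false : true ≡ false → ⊥
    true≢false ()

  IsColouring⇒isColouring : IsColouring G c → isColouring G c ≡ true
  IsColouring⇒isColouring is-colouring =
    cong₂ _∧_ (all≡true⁺ (allFin n) λ u → all≡true⁺ (allFin n) (properᵇ u))
              (all≡true⁺ (allFin n) λ u → all≡true⁺ (allFin n) λ x → all≡true⁺ (allFin n) λ v →
                 all≡true⁺ (allFin n) (compatibleᵇ u x v))
    where
    open IsColouring is-colouring
    properᵇ : ∀ u v → (not (isEdge (edge G u v)) ∨ not (col u == col v)) ≡ true
    properᵇ u v with isEdge (edge G u v) in uv | col u == col v in cu==cv
    ... | false | _     = refl
    ... | true  | false = refl
    ... | true  | true  = ⊥-elim (proper u v uv (==⇒≡ cu==cv))
    compatibleᵇ : ∀ u x v y →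
      not (isRed (edge G u x) ∧ isBlue (edge G v y) ∧ (col u == col v) ∧ (col x == col y)) ≡ true
    compatibleᵇ u x v y with edge G u x in ux | edge G v y in vy | col u == col v in cu==cv | col x == col y in cx==cy
    ... | none | _    | _     | _     = refl
    ... | blue | _    | _     | _     = refl
    ... | red  | none | _     | _     = refl
    ... | red  | red  | _     | _     = refl
    ... | red  | blue | false | _     = refl
    ... | red  | blue | true  | false = refl
    ... | red  | blue | true  | true  = ⊥-elim (compatible u x v y ux vy (==⇒≡ cu==cv) (==⇒≡ cx==cy))

  injective⇒IsColouring : (∀ u v → lookup c u ≡ lookup c v → u ≡ v) → IsColouring G c
  injective⇒IsColouring inj = record
    { proper     = λ u v uv cu≡cv → no-loop u v uv (inj u v cu≡cv)
    ; compatible = λ u x v y ux vy cu≡cv cx≡cy → red≢blue (inj u v cu≡cv) (inj x y cx≡cy) ux vy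
    }
    where
    no-loop : ∀ u v → isEdge (edge G u v) ≡ true → u ≢ v
    no-loop u u uu refl with () ← trans (sym uu) (cong isEdge (loopless G u))
    red≢blue : ∀ {u v x y} → u ≡ v → x ≡ y → edge G u x ≡ red → edge G v y ≢ blue
    red≢blue refl refl ux vy with () ← trans (sym ux) vy

IsColouring-resp-kernel : (G : TwoEdgeColouredGraph n) (c : Vec (Fin k) n) {k′ : ℕ} (c′ : Vec (Fin k′) n) →
  (∀ u v → lookup c′ u ≡ lookup c′ v → lookup c u ≡ lookup c v) → IsColouring G c → IsColouring G c′
IsColouring-resp-kernel G c c′ c′⇒c is-colouring = record
  { proper     = λ u v uv → proper u v uv ∘ c′⇒c u v
  ; compatible = λ u x v y ux vy cu≡cv → compatible u x v y ux vy (c′⇒c u v cu≡cv) ∘ c′⇒c x y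
  }
  where open IsColouring is-colouring

admissible : TwoEdgeColouredGraph n → Partition n d → Bool
admissible {d = d} G P = isColouring {k = d} G (Vec.tabulate (blockOf P))

isColouring-blockColouring : (G : TwoEdgeColouredGraph n) (P : Partition n d) (ι : Vec (Fin k) d) →
  distinct ι ≡ true → isColouring G (blockColouring P ι) ≡ admissible G P
isColouring-blockColouring {n = n} {d = d} {k = k} G P ι dist = bool-ext
  (λ valid → IsColouring⇒isColouring G blocks (IsColouring-resp-kernel G colours blocks same-block⇒same-colour
               (isColouring⇒IsColouring G colours valid)))
  (λ adm → IsColouring⇒isColouring G colours (IsColouring-resp-kernel G blocks colours same-colour⇒same-block
               (isColouring⇒IsColouring G blocks adm)))
  where
  colours : Vec (Fin k) n
  colours = blockColouring P ι
  blocks : Vec (Fin d) n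
  blocks = Vec.tabulate (blockOf P)
  same-block⇒same-colour : ∀ u v → lookup blocks u ≡ lookup blocks v → lookup colours u ≡ lookup colours v
  same-block⇒same-colour u v same = begin
    lookup colours u            ≡⟨ lookup∘tabulate (lookup ι ∘ blockOf P) u ⟩
    lookup ι (blockOf P u)      ≡⟨ cong (lookup ι) (trans (sym (lookup∘tabulate (blockOf P) u)) same) ⟩
    lookup ι (lookup blocks v)  ≡⟨ cong (lookup ι) (lookup∘tabulate (blockOf P) v) ⟩
    lookup ι (blockOf P v)      ≡⟨ lookup∘tabulate (lookup ι ∘ blockOf P) v ⟨
    lookup colours v            ∎
  same-colour⇒same-block : ∀ u v → lookup colours u ≡ lookup colours v → lookup blocks u ≡ lookup blocks v
  same-colour⇒same-block u v same = begin
    lookup blocks u   ≡⟨ lookup∘tabulate (blockOf P) u ⟩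
    blockOf P u       ≡⟨ lookup-injective ι dist _ _ (begin
                           lookup ι (blockOf P u) ≡⟨ lookup∘tabulate (lookup ι ∘ blockOf P) u ⟨
                           lookup colours u       ≡⟨ same ⟩
                           lookup colours v       ≡⟨ lookup∘tabulate (lookup ι ∘ blockOf P) v ⟩
                           lookup ι (blockOf P v) ∎) ⟩
    blockOf P v       ≡⟨ lookup∘tabulate (blockOf P) v ⟨
    lookup blocks v   ∎

numColourings≡∑ : (G : TwoEdgeColouredGraph n) (k : ℕ) →
                  numColourings G k ≡ ∑[ c ← allMaps n k ] ind (isColouring G c) 1
numColourings≡∑ {n} G k =
  trans (length≡∑1 (filterᵇ (isColouring G) (allMaps n k))) (∑-filterᵇ (isColouring G) (allMaps n k) (λ _ → 1))

numColourings-by-partition : (G : TwoEdgeColouredGraph n) (k : ℕ) →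
  numColourings G k ≡ ∑ (partitions n) λ (d , P) → ind (admissible G P) (k P′ d)
numColourings-by-partition {n} G k = begin
  numColourings G k
    ≡⟨ numColourings≡∑ G k ⟩
  ∑[ c ← allMaps n k ] ind (isColouring G c) 1
    ≡⟨ ∑-allMaps-by-partition n k _ ⟩
  ∑ (partitions n) (λ (d , P) → ∑[ ι ← injections d k ] ind (isColouring G (blockColouring P ι)) 1)
    ≡⟨ ∑-cong (partitions n) count-injections ⟩
  ∑ (partitions n) (λ (d , P) → ind (admissible G P) (k P′ d))
    ∎
  where
  count-injections : ∀ ((d , P) : Σ ℕ (Partition n)) →
    ∑[ ι ← injections d k ] ind (isColouring G (blockColouring P ι)) 1 ≡ ind (admissible G P) (k P′ d)
  count-injections (d , P) = begin
    ∑[ ι ← injections d k ] ind (isColouring G (blockColouring P ι)) 1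
      ≡⟨ ∑-cong-All (All.map (λ {ι} dist → cong (λ b → ind b 1) (isColouring-blockColouring G P ι dist))
                             (injections-distinct d k)) ⟩
    ∑[ ι ← injections d k ] ind (admissible G P) 1
      ≡⟨ ∑-ind (injections d k) (admissible G P) (λ _ → 1) ⟩
    ind (admissible G P) (∑[ ι ← injections d k ] 1)
      ≡⟨ cong (ind (admissible G P)) (trans (sym (length≡∑1 (injections d k))) (length-injections d k)) ⟩
    ind (admissible G P) (k P′ d)
      ∎

admissible-discrete : (G : TwoEdgeColouredGraph n) → admissible G (discrete n) ≡ true
admissible-discrete {n} G = IsColouring⇒isColouring G blocks (injective⇒IsColouring G blocks λ u v same → begin
  u                       ≡⟨ blockOf-discrete n u ⟨
  blockOf (discrete n) u  ≡⟨ lookup∘tabulate (blockOf (discrete n)) u ⟨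
  lookup blocks u         ≡⟨ same ⟩
  lookup blocks v         ≡⟨ lookup∘tabulate (blockOf (discrete n)) v ⟩
  blockOf (discrete n) v  ≡⟨ blockOf-discrete n v ⟩
  v                       ∎)
  where
  blocks : Vec (Fin n) n
  blocks = Vec.tabulate (blockOf (discrete n))

-- Polynomials over ℚ

ℚ-ring : AlmostCommutativeRing 0ℓ 0ℓ
ℚ-ring = fromCommutativeRing ℚ.+-*-commutativeRing (λ x → dec⇒maybe (0ℚ ℚ.≟ x))

-- ℤtoℚ z = z / 1 is only computed for concrete z; fromℤ z is the same rational in normal form.
fromℤ : ℤ → ℚ
fromℤ z = mkℚ z 0 (Coprime.sym (Coprime.1-coprimeTo _))

ℤtoℚ≡fromℤ : ∀ z → ℤtoℚ z ≡ fromℤ z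
ℤtoℚ≡fromℤ z = ℚ.↥p/↧p≡p (fromℤ z)

ℤtoℚ-+ : ∀ a b → ℤtoℚ (a ℤ.+ b) ≡ ℤtoℚ a ℚ.+ ℤtoℚ b
ℤtoℚ-+ a b = begin
  ℤtoℚ (a ℤ.+ b)       ≡⟨ ℤtoℚ≡fromℤ (a ℤ.+ b) ⟩
  fromℤ (a ℤ.+ b)      ≡⟨ ℚ.toℚᵘ-injective (ℚᵘ.≃-trans (ℚᵘ.*≡* (cross a b)) (ℚᵘ.≃-sym (ℚ.toℚᵘ-homo-+ (fromℤ a) (fromℤ b)))) ⟩
  fromℤ a ℚ.+ fromℤ b  ≡⟨ cong₂ ℚ._+_ (ℤtoℚ≡fromℤ a) (ℤtoℚ≡fromℤ b) ⟨
  ℤtoℚ a ℚ.+ ℤtoℚ b    ∎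
  where
  cross : ∀ a b → (a ℤ.+ b) ℤ.* ℤ.+ 1 ≡ (a ℤ.* ℤ.+ 1 ℤ.+ b ℤ.* ℤ.+ 1) ℤ.* ℤ.+ 1
  cross = ℤ-Solver.solve-∀

ℤtoℚ-* : ∀ a b → ℤtoℚ (a ℤ.* b) ≡ ℤtoℚ a ℚ.* ℤtoℚ b
ℤtoℚ-* a b = begin
  ℤtoℚ (a ℤ.* b)       ≡⟨ ℤtoℚ≡fromℤ (a ℤ.* b) ⟩
  fromℤ (a ℤ.* b)      ≡⟨ ℚ.toℚᵘ-injective (ℚᵘ.≃-sym (ℚ.toℚᵘ-homo-* (fromℤ a) (fromℤ b))) ⟩
  fromℤ a ℚ.* fromℤ b  ≡⟨ cong₂ ℚ._*_ (ℤtoℚ≡fromℤ a) (ℤtoℚ≡fromℤ b) ⟨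
  ℤtoℚ a ℚ.* ℤtoℚ b    ∎

ℤtoℚ-neg : ∀ a → ℤtoℚ (ℤ.- a) ≡ ℚ.- ℤtoℚ a
ℤtoℚ-neg a = begin
  ℤtoℚ (ℤ.- a)   ≡⟨ ℤtoℚ≡fromℤ (ℤ.- a) ⟩
  fromℤ (ℤ.- a)  ≡⟨ ℚ.toℚᵘ-injective (ℚᵘ.≃-sym (ℚ.toℚᵘ-homo‿- (fromℤ a))) ⟩
  ℚ.- fromℤ a    ≡⟨ cong ℚ.-_ (ℤtoℚ≡fromℤ a) ⟨
  ℚ.- ℤtoℚ a     ∎

ℤtoℚ-injective : ∀ {a b} → ℤtoℚ a ≡ ℤtoℚ b → a ≡ b
ℤtoℚ-injective {a} {b} eq = cong ↥_ (trans (sym (ℤtoℚ≡fromℤ a)) (trans eq (ℤtoℚ≡fromℤ b)))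

*-denominator : ∀ q → q ℚ.* ℤtoℚ (ℤ.+ ↧ₙ q) ≡ ℤtoℚ (↥ q)
*-denominator q@(mkℚ a d-1 _) = begin
  q ℚ.* ℤtoℚ (ℤ.+ suc d-1)   ≡⟨ cong (q ℚ.*_) (ℤtoℚ≡fromℤ (ℤ.+ suc d-1)) ⟩
  q ℚ.* fromℤ (ℤ.+ suc d-1)
    ≡⟨ ℚ.toℚᵘ-injective (ℚᵘ.≃-trans (ℚ.toℚᵘ-homo-* q (fromℤ (ℤ.+ suc d-1))) (ℚᵘ.*≡* (cross a (ℤ.+ suc d-1)))) ⟩
  fromℤ a                    ≡⟨ ℤtoℚ≡fromℤ a ⟨
  ℤtoℚ a                     ∎
  where
  cross : ∀ a d → (a ℤ.* d) ℤ.* ℤ.+ 1 ≡ a ℤ.* (d ℤ.* ℤ.+ 1)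
  cross = ℤ-Solver.solve-∀

denominator≡1⇒integer : ∀ q → ↧ₙ q ≡ 1 → q ≡ ℤtoℚ (↥ q)
denominator≡1⇒integer (mkℚ a zero _) refl = sym (ℤtoℚ≡fromℤ a)

ℕtoℚ-+ : ∀ m n → ℕtoℚ (m + n) ≡ ℕtoℚ m ℚ.+ ℕtoℚ n
ℕtoℚ-+ m n = ℤtoℚ-+ (ℤ.+ m) (ℤ.+ n)

ℕtoℚ-* : ∀ m n → ℕtoℚ (m * n) ≡ ℕtoℚ m ℚ.* ℕtoℚ n
ℕtoℚ-* m n = trans (cong ℤtoℚ (ℤ.pos-* m n)) (ℤtoℚ-* (ℤ.+ m) (ℤ.+ n))

ℕtoℚ-suc : ∀ n → ℕtoℚ (suc n) ≡ ℕtoℚ n ℚ.+ 1ℚ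
ℕtoℚ-suc n = trans (cong ℕtoℚ (ℕ.+-comm 1 n)) (ℕtoℚ-+ n 1)

ℕtoℚ-∸ : ∀ {m n} → n ≤ m → ℕtoℚ (m ∸ n) ≡ ℕtoℚ m ℚ.- ℕtoℚ n
ℕtoℚ-∸ {m} {n} n≤m = begin
  ℕtoℚ (m ∸ n)                          ≡⟨ add-sub (ℕtoℚ (m ∸ n)) (ℕtoℚ n) ⟩
  (ℕtoℚ (m ∸ n) ℚ.+ ℕtoℚ n) ℚ.- ℕtoℚ n  ≡⟨ cong (ℚ._- ℕtoℚ n) (trans (sym (ℕtoℚ-+ (m ∸ n) n)) (cong ℕtoℚ (ℕ.m∸n+n≡m n≤m))) ⟩
  ℕtoℚ m ℚ.- ℕtoℚ n                     ∎
  where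
  add-sub : ∀ x y → x ≡ (x ℚ.+ y) ℚ.- y
  add-sub = solve-∀ ℚ-ring

ℤtoℚ-sub : ∀ a b → ℤtoℚ (a ℤ.- b) ≡ ℤtoℚ a ℚ.- ℤtoℚ b
ℤtoℚ-sub a b = trans (ℤtoℚ-+ a (ℤ.- b)) (cong (ℤtoℚ a ℚ.+_) (ℤtoℚ-neg b))

addPoly : List ℚ → List ℚ → List ℚ
addPoly []      r       = r
addPoly (a ∷ p) []      = a ∷ p
addPoly (a ∷ p) (b ∷ r) = a ℚ.+ b ∷ addPoly p r

scalePoly : ℚ → List ℚ → List ℚ
scalePoly c = map (c ℚ.*_)

mulLinear : ℚ → List ℚ → List ℚ
mulLinear c p = addPoly (0ℚ ∷ p) (scalePoly c p)

shiftPoly : List ℚ → List ℚ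
shiftPoly []      = []
shiftPoly (a ∷ p) = addPoly (a ∷ []) (mulLinear 1ℚ (shiftPoly p))

evalPoly-addPoly : ∀ p r x → evalPoly (addPoly p r) x ≡ evalPoly p x ℚ.+ evalPoly r x
evalPoly-addPoly []      r       x = sym (ℚ.+-identityˡ _)
evalPoly-addPoly (a ∷ p) []      x = sym (ℚ.+-identityʳ _)
evalPoly-addPoly (a ∷ p) (b ∷ r) x = begin
  (a ℚ.+ b) ℚ.+ x ℚ.* evalPoly (addPoly p r) x             ≡⟨ cong (λ y → (a ℚ.+ b) ℚ.+ x ℚ.* y) (evalPoly-addPoly p r x) ⟩
  (a ℚ.+ b) ℚ.+ x ℚ.* (evalPoly p x ℚ.+ evalPoly r x)      ≡⟨ regroup a b x (evalPoly p x) (evalPoly r x) ⟩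
  (a ℚ.+ x ℚ.* evalPoly p x) ℚ.+ (b ℚ.+ x ℚ.* evalPoly r x) ∎
  where
  regroup : ∀ a b x y z → (a ℚ.+ b) ℚ.+ x ℚ.* (y ℚ.+ z) ≡ (a ℚ.+ x ℚ.* y) ℚ.+ (b ℚ.+ x ℚ.* z)
  regroup = solve-∀ ℚ-ring

evalPoly-scalePoly : ∀ c p x → evalPoly (scalePoly c p) x ≡ c ℚ.* evalPoly p x
evalPoly-scalePoly c []      x = sym (ℚ.*-zeroʳ c)
evalPoly-scalePoly c (a ∷ p) x = begin
  c ℚ.* a ℚ.+ x ℚ.* evalPoly (scalePoly c p) x  ≡⟨ cong (λ y → c ℚ.* a ℚ.+ x ℚ.* y) (evalPoly-scalePoly c p x) ⟩
  c ℚ.* a ℚ.+ x ℚ.* (c ℚ.* evalPoly p x)        ≡⟨ regroup c a x (evalPoly p x) ⟩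
  c ℚ.* (a ℚ.+ x ℚ.* evalPoly p x)              ∎
  where
  regroup : ∀ c a x y → c ℚ.* a ℚ.+ x ℚ.* (c ℚ.* y) ≡ c ℚ.* (a ℚ.+ x ℚ.* y)
  regroup = solve-∀ ℚ-ring

evalPoly-mulLinear : ∀ c p x → evalPoly (mulLinear c p) x ≡ (x ℚ.+ c) ℚ.* evalPoly p x
evalPoly-mulLinear c p x = begin
  evalPoly (mulLinear c p) x                              ≡⟨ evalPoly-addPoly (0ℚ ∷ p) (scalePoly c p) x ⟩
  (0ℚ ℚ.+ x ℚ.* evalPoly p x) ℚ.+ evalPoly (scalePoly c p) x
    ≡⟨ cong ((0ℚ ℚ.+ x ℚ.* evalPoly p x) ℚ.+_) (evalPoly-scalePoly c p x) ⟩
  (0ℚ ℚ.+ x ℚ.* evalPoly p x) ℚ.+ c ℚ.* evalPoly p x      ≡⟨ regroup c x (evalPoly p x) ⟩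
  (x ℚ.+ c) ℚ.* evalPoly p x                              ∎
  where
  regroup : ∀ c x y → (0ℚ ℚ.+ x ℚ.* y) ℚ.+ c ℚ.* y ≡ (x ℚ.+ c) ℚ.* y
  regroup = solve-∀ ℚ-ring

evalPoly-shiftPoly : ∀ p x → evalPoly (shiftPoly p) x ≡ evalPoly p (x ℚ.+ 1ℚ)
evalPoly-shiftPoly []      x = refl
evalPoly-shiftPoly (a ∷ p) x = begin
  evalPoly (addPoly (a ∷ []) (mulLinear 1ℚ (shiftPoly p))) x
    ≡⟨ evalPoly-addPoly (a ∷ []) (mulLinear 1ℚ (shiftPoly p)) x ⟩
  (a ℚ.+ x ℚ.* 0ℚ) ℚ.+ evalPoly (mulLinear 1ℚ (shiftPoly p)) x
    ≡⟨ cong ((a ℚ.+ x ℚ.* 0ℚ) ℚ.+_) (evalPoly-mulLinear 1ℚ (shiftPoly p) x) ⟩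
  (a ℚ.+ x ℚ.* 0ℚ) ℚ.+ (x ℚ.+ 1ℚ) ℚ.* evalPoly (shiftPoly p) x
    ≡⟨ cong (λ y → (a ℚ.+ x ℚ.* 0ℚ) ℚ.+ (x ℚ.+ 1ℚ) ℚ.* y) (evalPoly-shiftPoly p x) ⟩
  (a ℚ.+ x ℚ.* 0ℚ) ℚ.+ (x ℚ.+ 1ℚ) ℚ.* evalPoly p (x ℚ.+ 1ℚ)
    ≡⟨ regroup a x (evalPoly p (x ℚ.+ 1ℚ)) ⟩
  a ℚ.+ (x ℚ.+ 1ℚ) ℚ.* evalPoly p (x ℚ.+ 1ℚ)
    ∎
  where
  regroup : ∀ a x y → (a ℚ.+ x ℚ.* 0ℚ) ℚ.+ (x ℚ.+ 1ℚ) ℚ.* y ≡ a ℚ.+ (x ℚ.+ 1ℚ) ℚ.* y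
  regroup = solve-∀ ℚ-ring

length-addPoly : ∀ p r {L} → length p ≤ L → length r ≤ L → length (addPoly p r) ≤ L
length-addPoly []      r       _           r≤L         = r≤L
length-addPoly (a ∷ p) []      p≤L         _           = p≤L
length-addPoly (a ∷ p) (b ∷ r) (ℕ.s≤s p≤L) (ℕ.s≤s r≤L) = ℕ.s≤s (length-addPoly p r p≤L r≤L)

length-mulLinear : ∀ c p → length (mulLinear c p) ≤ suc (length p)
length-mulLinear c p =
  length-addPoly (0ℚ ∷ p) (scalePoly c p) ℕ.≤-refl (ℕ.m≤n⇒m≤1+n (ℕ.≤-reflexive (length-map (c ℚ.*_) p)))

length-shiftPoly : ∀ p → length (shiftPoly p) ≤ length p
length-shiftPoly []      = ℕ.z≤n
length-shiftPoly (a ∷ p) = length-addPoly (a ∷ []) (mulLinear 1ℚ (shiftPoly p)) (ℕ.s≤s ℕ.z≤n)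
  (ℕ.≤-trans (length-mulLinear 1ℚ (shiftPoly p)) (ℕ.s≤s (length-shiftPoly p)))

*-cancelˡ-≡0 : ∀ p {e} .{{_ : ℚ.NonZero p}} → p ℚ.* e ≡ 0ℚ → e ≡ 0ℚ
*-cancelˡ-≡0 p {e} pe≡0 = begin
  e                         ≡⟨ ℚ.*-identityˡ e ⟨
  1ℚ ℚ.* e                  ≡⟨ cong (ℚ._* e) (ℚ.*-inverseˡ p) ⟨
  (ℚ.1/ p) ℚ.* p ℚ.* e      ≡⟨ ℚ.*-assoc (ℚ.1/ p) p e ⟩
  (ℚ.1/ p) ℚ.* (p ℚ.* e)    ≡⟨ cong ((ℚ.1/ p) ℚ.*_) pe≡0 ⟩
  (ℚ.1/ p) ℚ.* 0ℚ           ≡⟨ ℚ.*-zeroʳ (ℚ.1/ p) ⟩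
  0ℚ                        ∎

-- Induction on a bound L for the length, as shiftPoly p is no subterm of a ∷ p: a = p(0) = 0, so
-- (1 + k) · p(1 + k) = 0 for every k, and the shifted tail vanishes on ℕ.
vanishing-on-ℕ⇒vanishing : ∀ L p → length p ≤ L → (∀ k → evalPoly p (ℕtoℚ k) ≡ 0ℚ) → ∀ x → evalPoly p x ≡ 0ℚ
vanishing-on-ℕ⇒vanishing L       []      _           _      x = refl
vanishing-on-ℕ⇒vanishing (suc L) (a ∷ p) (ℕ.s≤s p≤L) p[k]≡0 x = begin
  a ℚ.+ x ℚ.* evalPoly p x   ≡⟨ cong₂ (λ u v → u ℚ.+ x ℚ.* v) a≡0 p[x]≡0 ⟩
  0ℚ ℚ.+ x ℚ.* 0ℚ            ≡⟨ annihilate x ⟩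
  0ℚ                         ∎
  where
  annihilate : ∀ x → 0ℚ ℚ.+ x ℚ.* 0ℚ ≡ 0ℚ
  annihilate = solve-∀ ℚ-ring
  a≡0 : a ≡ 0ℚ
  a≡0 = trans (sym (trans (cong (a ℚ.+_) (ℚ.*-zeroˡ (evalPoly p 0ℚ))) (ℚ.+-identityʳ a))) (p[k]≡0 0)
  p[1+k]≡0 : ∀ k → evalPoly p (ℕtoℚ (suc k)) ≡ 0ℚ
  p[1+k]≡0 k = *-cancelˡ-≡0 (fromℤ (ℤ.+ suc k)) (begin
    fromℤ (ℤ.+ suc k) ℚ.* evalPoly p (ℕtoℚ (suc k))
      ≡⟨ cong (ℚ._* evalPoly p (ℕtoℚ (suc k))) (ℤtoℚ≡fromℤ (ℤ.+ suc k)) ⟨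
    ℕtoℚ (suc k) ℚ.* evalPoly p (ℕtoℚ (suc k))               ≡⟨ ℚ.+-identityˡ _ ⟨
    0ℚ ℚ.+ ℕtoℚ (suc k) ℚ.* evalPoly p (ℕtoℚ (suc k))        ≡⟨ cong (ℚ._+ _) a≡0 ⟨
    a ℚ.+ ℕtoℚ (suc k) ℚ.* evalPoly p (ℕtoℚ (suc k))         ≡⟨ p[k]≡0 (suc k) ⟩
    0ℚ                                                       ∎)
  shift-vanishes : ∀ y → evalPoly (shiftPoly p) y ≡ 0ℚ
  shift-vanishes = vanishing-on-ℕ⇒vanishing L (shiftPoly p) (ℕ.≤-trans (length-shiftPoly p) p≤L) λ k →
    trans (evalPoly-shiftPoly p (ℕtoℚ k)) (trans (cong (evalPoly p) (sym (ℕtoℚ-suc k))) (p[1+k]≡0 k))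
  p[x]≡0 : evalPoly p x ≡ 0ℚ
  p[x]≡0 = begin
    evalPoly p x                          ≡⟨ cong (evalPoly p) (sub-add x) ⟩
    evalPoly p ((x ℚ.- 1ℚ) ℚ.+ 1ℚ)        ≡⟨ evalPoly-shiftPoly p (x ℚ.- 1ℚ) ⟨
    evalPoly (shiftPoly p) (x ℚ.- 1ℚ)     ≡⟨ shift-vanishes (x ℚ.- 1ℚ) ⟩
    0ℚ                                    ∎
    where
    sub-add : ∀ x → x ≡ (x ℚ.- 1ℚ) ℚ.+ 1ℚ
    sub-add = solve-∀ ℚ-ring

agree-on-ℕ⇒agree : ∀ p r → (∀ k → evalPoly p (ℕtoℚ k) ≡ evalPoly r (ℕtoℚ k)) → ∀ x → evalPoly p x ≡ evalPoly r x
agree-on-ℕ⇒agree p r p≗r x = begin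
  evalPoly p x                                                    ≡⟨ sub-add (evalPoly p x) (evalPoly r x) ⟩
  (evalPoly p x ℚ.+ (ℚ.- 1ℚ) ℚ.* evalPoly r x) ℚ.+ evalPoly r x    ≡⟨ cong (ℚ._+ evalPoly r x) (difference-vanishes x) ⟩
  0ℚ ℚ.+ evalPoly r x                                             ≡⟨ ℚ.+-identityˡ (evalPoly r x) ⟩
  evalPoly r x                                                    ∎
  where
  sub-add : ∀ y z → y ≡ (y ℚ.+ (ℚ.- 1ℚ) ℚ.* z) ℚ.+ z
  sub-add = solve-∀ ℚ-ring
  sub-self : ∀ z → z ℚ.+ (ℚ.- 1ℚ) ℚ.* z ≡ 0ℚ
  sub-self = solve-∀ ℚ-ring
  difference : List ℚ
  difference = addPoly p (scalePoly (ℚ.- 1ℚ) r)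
  evalPoly-difference : ∀ y → evalPoly difference y ≡ evalPoly p y ℚ.+ (ℚ.- 1ℚ) ℚ.* evalPoly r y
  evalPoly-difference y =
    trans (evalPoly-addPoly p (scalePoly (ℚ.- 1ℚ) r) y) (cong (evalPoly p y ℚ.+_) (evalPoly-scalePoly (ℚ.- 1ℚ) r y))
  difference-vanishes : ∀ y → evalPoly p y ℚ.+ (ℚ.- 1ℚ) ℚ.* evalPoly r y ≡ 0ℚ
  difference-vanishes y = trans (sym (evalPoly-difference y))
    (vanishing-on-ℕ⇒vanishing (length difference) difference ℕ.≤-refl (λ k → begin
      evalPoly difference (ℕtoℚ k)                                       ≡⟨ evalPoly-difference (ℕtoℚ k) ⟩
      evalPoly p (ℕtoℚ k) ℚ.+ (ℚ.- 1ℚ) ℚ.* evalPoly r (ℕtoℚ k)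
        ≡⟨ cong (λ z → z ℚ.+ (ℚ.- 1ℚ) ℚ.* evalPoly r (ℕtoℚ k)) (p≗r k) ⟩
      evalPoly r (ℕtoℚ k) ℚ.+ (ℚ.- 1ℚ) ℚ.* evalPoly r (ℕtoℚ k)           ≡⟨ sub-self (evalPoly r (ℕtoℚ k)) ⟩
      0ℚ                                                                 ∎) y)

fallingℚ : ℚ → ℕ → ℚ
fallingℚ x zero    = 1ℚ
fallingℚ x (suc d) = (x ℚ.- ℕtoℚ d) ℚ.* fallingℚ x d

fallingPoly : ℕ → List ℚ
fallingPoly zero    = 1ℚ ∷ []
fallingPoly (suc d) = mulLinear (ℚ.- ℕtoℚ d) (fallingPoly d)

evalPoly-fallingPoly : ∀ d x → evalPoly (fallingPoly d) x ≡ fallingℚ x d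
evalPoly-fallingPoly zero    x = trans (cong (1ℚ ℚ.+_) (ℚ.*-zeroʳ x)) (ℚ.+-identityʳ 1ℚ)
evalPoly-fallingPoly (suc d) x =
  trans (evalPoly-mulLinear (ℚ.- ℕtoℚ d) (fallingPoly d) x) (cong ((x ℚ.- ℕtoℚ d) ℚ.*_) (evalPoly-fallingPoly d x))

P′-vanishes : ∀ {k d} → k < d → k P′ d ≡ 0
P′-vanishes {k} {suc d} (ℕ.s≤s k≤d) with ℕ.m≤n⇒m<n∨m≡n k≤d
... | inj₁ k<d  = trans (cong ((k ∸ d) *_) (P′-vanishes k<d)) (ℕ.*-zeroʳ (k ∸ d))
... | inj₂ refl = cong (_* (k P′ k)) (ℕ.n∸n≡0 k)

fallingℚ-vanishes : ∀ {k d} → k < d → fallingℚ (ℕtoℚ k) d ≡ 0ℚ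
fallingℚ-vanishes {k} {suc d} (ℕ.s≤s k≤d) with ℕ.m≤n⇒m<n∨m≡n k≤d
... | inj₁ k<d  = trans (cong ((ℕtoℚ k ℚ.- ℕtoℚ d) ℚ.*_) (fallingℚ-vanishes k<d)) (ℚ.*-zeroʳ (ℕtoℚ k ℚ.- ℕtoℚ d))
... | inj₂ refl = trans (cong (ℚ._* fallingℚ (ℕtoℚ k) k) (ℚ.+-inverseʳ (ℕtoℚ k))) (ℚ.*-zeroˡ (fallingℚ (ℕtoℚ k) k))

ℕtoℚ-P′ : ∀ k d → ℕtoℚ (k P′ d) ≡ fallingℚ (ℕtoℚ k) d
ℕtoℚ-P′ k zero = refl
ℕtoℚ-P′ k (suc d) with d ℕ.≤? k
... | yes d≤k = trans (ℕtoℚ-* (k ∸ d) (k P′ d)) (cong₂ ℚ._*_ (ℕtoℚ-∸ d≤k) (ℕtoℚ-P′ k d))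
... | no  d≰k = trans (cong ℕtoℚ (P′-vanishes k<1+d)) (sym (fallingℚ-vanishes k<1+d))
  where
  k<1+d : k < suc d
  k<1+d = ℕ.m≤n⇒m≤1+n (ℕ.≰⇒> d≰k)

∑ℚ : List A → (A → ℚ) → ℚ
∑ℚ []       f = 0ℚ
∑ℚ (x ∷ xs) f = f x ℚ.+ ∑ℚ xs f

syntax ∑ℚ xs (λ x → e) = ∑ℚ[ x ← xs ] e

∑ℚ-cong : (xs : List A) {f g : A → ℚ} → (∀ x → f x ≡ g x) → ∑ℚ xs f ≡ ∑ℚ xs g
∑ℚ-cong []       f≗g = refl
∑ℚ-cong (x ∷ xs) f≗g = cong₂ ℚ._+_ (f≗g x) (∑ℚ-cong xs f≗g)

ℕtoℚ-∑ : (xs : List A) (f : A → ℕ) → ℕtoℚ (∑ xs f) ≡ ∑ℚ xs (ℕtoℚ ∘ f)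
ℕtoℚ-∑ []       f = refl
ℕtoℚ-∑ (x ∷ xs) f = trans (ℕtoℚ-+ (f x) (∑ xs f)) (cong (ℕtoℚ (f x) ℚ.+_) (ℕtoℚ-∑ xs f))

∑Poly : List A → (A → List ℚ) → List ℚ
∑Poly []       f = []
∑Poly (x ∷ xs) f = addPoly (f x) (∑Poly xs f)

evalPoly-∑Poly : (xs : List A) (f : A → List ℚ) (y : ℚ) → evalPoly (∑Poly xs f) y ≡ ∑ℚ[ x ← xs ] evalPoly (f x) y
evalPoly-∑Poly []       f y = refl
evalPoly-∑Poly (x ∷ xs) f y =
  trans (evalPoly-addPoly (f x) (∑Poly xs f) y) (cong (evalPoly (f x) y ℚ.+_) (evalPoly-∑Poly xs f y))

chromaticPoly : TwoEdgeColouredGraph n → List ℚ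
chromaticPoly {n} G = ∑Poly (partitions n) λ (d , P) → if admissible G P then fallingPoly d else []

evalPoly-chromaticPoly : (G : TwoEdgeColouredGraph n) (x : ℚ) →
  evalPoly (chromaticPoly G) x ≡ ∑ℚ (partitions n) λ (d , P) → if admissible G P then fallingℚ x d else 0ℚ
evalPoly-chromaticPoly {n} G x = trans (evalPoly-∑Poly (partitions n) _ x) (∑ℚ-cong (partitions n) λ (d , P) →
  trans (if-float (λ p → evalPoly p x) (admissible G P)) (if-cong-then (admissible G P) (evalPoly-fallingPoly d x)))

chromaticPoly-isChromatic : (G : TwoEdgeColouredGraph n) → IsChromaticPoly G (chromaticPoly G)
chromaticPoly-isChromatic {n} G k = begin
  evalPoly (chromaticPoly G) (ℕtoℚ k)
    ≡⟨ evalPoly-chromaticPoly G (ℕtoℚ k) ⟩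
  ∑ℚ (partitions n) (λ (d , P) → if admissible G P then fallingℚ (ℕtoℚ k) d else 0ℚ)
    ≡⟨ ∑ℚ-cong (partitions n) (λ (d , P) →
         sym (trans (if-float ℕtoℚ (admissible G P)) (if-cong-then (admissible G P) (ℕtoℚ-P′ k d)))) ⟩
  ∑ℚ (partitions n) (λ (d , P) → ℕtoℚ (ind (admissible G P) (k P′ d)))
    ≡⟨ ℕtoℚ-∑ (partitions n) _ ⟨
  ℕtoℚ (∑ (partitions n) λ (d , P) → ind (admissible G P) (k P′ d))
    ≡⟨ cong ℕtoℚ (numColourings-by-partition G k) ⟨
  ℕtoℚ (numColourings G k)
    ∎

-- Rational roots of chromatic polynomials

∣i^n∣≡∣i∣^n : ∀ i n → ℤ.∣ i ℤ.^ n ∣ ≡ ℤ.∣ i ∣ ℕ.^ n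
∣i^n∣≡∣i∣^n i zero    = refl
∣i^n∣≡∣i∣^n i (suc n) = trans (ℤ.abs-* i (i ℤ.^ n)) (cong (ℤ.∣ i ∣ *_) (∣i^n∣≡∣i∣^n i n))

coprime-∣^⇒≡1 : ∀ {m x} n → Coprime m x → m ∣ x ℕ.^ n → m ≡ 1
coprime-∣^⇒≡1 zero    _        m∣1     = ∣1⇒≡1 m∣1
coprime-∣^⇒≡1 (suc n) coprime m∣x^1+n = coprime-∣^⇒≡1 n coprime (Coprime.coprime-divisor coprime m∣x^1+n)

denominator-coprime : ∀ q → Coprime (↧ₙ q) ℤ.∣ ↥ q ∣
denominator-coprime (mkℚ _ _ coprime) = Coprime.sym (Coprime.recompute coprime)

module RationalRoot (q : ℚ) where
  private
    a b : ℤ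
    a = ↥ q
    b = ℤ.+ ↧ₙ q

  -- With q = a/b in lowest terms, the value f at q of a monic integer polynomial of degree d
  -- satisfies bᵈ f ≡ aᵈ (mod b), and that of an integer polynomial of degree < d satisfies
  -- bᵈ f ≡ 0 (mod b).
  MonicValue : ℕ → ℚ → Set
  MonicValue d f = ∃ λ w → ℤtoℚ (b ℤ.^ d) ℚ.* f ≡ ℤtoℚ (a ℤ.^ d ℤ.+ b ℤ.* w)

  LowDegreeValue : ℕ → ℚ → Set
  LowDegreeValue d f = ∃ λ w → ℤtoℚ (b ℤ.^ d) ℚ.* f ≡ ℤtoℚ (b ℤ.* w)

  fallingℚ-monic : ∀ d → MonicValue d (fallingℚ q d)
  fallingℚ-monic zero    = 0ℤ , trans (ℚ.*-identityʳ (ℤtoℚ 1ℤ)) (cong ℤtoℚ (pad b))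
    where
    pad : ∀ b → 1ℤ ≡ 1ℤ ℤ.+ b ℤ.* 0ℤ
    pad = ℤ-Solver.solve-∀
  fallingℚ-monic (suc d) = w′ , (begin
    ℤtoℚ (b ℤ.* b ℤ.^ d) ℚ.* ((q ℚ.- dq) ℚ.* F)
      ≡⟨ cong (ℚ._* ((q ℚ.- dq) ℚ.* F)) (ℤtoℚ-* b (b ℤ.^ d)) ⟩
    (bq ℚ.* ℤtoℚ (b ℤ.^ d)) ℚ.* ((q ℚ.- dq) ℚ.* F)
      ≡⟨ regroup bq (ℤtoℚ (b ℤ.^ d)) q dq F ⟩
    (q ℚ.* bq ℚ.- bq ℚ.* dq) ℚ.* (ℤtoℚ (b ℤ.^ d) ℚ.* F)
      ≡⟨ cong₂ (λ u v → (u ℚ.- bq ℚ.* dq) ℚ.* v) (*-denominator q) bᵈF≡ ⟩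
    (ℤtoℚ a ℚ.- bq ℚ.* dq) ℚ.* ℤtoℚ (a ℤ.^ d ℤ.+ b ℤ.* w)
      ≡⟨ cong (ℚ._* ℤtoℚ (a ℤ.^ d ℤ.+ b ℤ.* w))
              (trans (ℤtoℚ-sub a (b ℤ.* ℤ.+ d)) (cong (λ z → ℤtoℚ a ℚ.- z) (ℤtoℚ-* b (ℤ.+ d)))) ⟨
    ℤtoℚ (a ℤ.- b ℤ.* ℤ.+ d) ℚ.* ℤtoℚ (a ℤ.^ d ℤ.+ b ℤ.* w)
      ≡⟨ ℤtoℚ-* (a ℤ.- b ℤ.* ℤ.+ d) (a ℤ.^ d ℤ.+ b ℤ.* w) ⟨
    ℤtoℚ ((a ℤ.- b ℤ.* ℤ.+ d) ℤ.* (a ℤ.^ d ℤ.+ b ℤ.* w))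
      ≡⟨ cong ℤtoℚ (expand a b w (a ℤ.^ d) (ℤ.+ d)) ⟩
    ℤtoℚ (a ℤ.^ suc d ℤ.+ b ℤ.* w′)
      ∎)
    where
    bq dq F : ℚ
    bq = ℤtoℚ b
    dq = ℕtoℚ d
    F = fallingℚ q d
    w w′ : ℤ
    w = proj₁ (fallingℚ-monic d)
    w′ = a ℤ.* w ℤ.- ℤ.+ d ℤ.* a ℤ.^ d ℤ.- b ℤ.* ℤ.+ d ℤ.* w
    bᵈF≡ : ℤtoℚ (b ℤ.^ d) ℚ.* F ≡ ℤtoℚ (a ℤ.^ d ℤ.+ b ℤ.* w)
    bᵈF≡ = proj₂ (fallingℚ-monic d)
    regroup : ∀ B Bᵈ q D F → (B ℚ.* Bᵈ) ℚ.* ((q ℚ.- D) ℚ.* F) ≡ (q ℚ.* B ℚ.- B ℚ.* D) ℚ.* (Bᵈ ℚ.* F)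
    regroup = solve-∀ ℚ-ring
    expand : ∀ a b w P D → (a ℤ.- b ℤ.* D) ℤ.* (P ℤ.+ b ℤ.* w) ≡ a ℤ.* P ℤ.+ b ℤ.* (a ℤ.* w ℤ.- D ℤ.* P ℤ.- b ℤ.* D ℤ.* w)
    expand = ℤ-Solver.solve-∀

  monic⇒lowDegree : ∀ {d n f} → d < n → MonicValue d f → LowDegreeValue n f
  monic⇒lowDegree {d} {suc n} {f} (ℕ.s≤s d≤n) (w , bᵈf≡) = b ℤ.^ (n ∸ d) ℤ.* (a ℤ.^ d ℤ.+ b ℤ.* w) , (begin
    ℤtoℚ (b ℤ.^ suc n) ℚ.* f
      ≡⟨ cong (λ z → ℤtoℚ z ℚ.* f) split-power ⟩
    ℤtoℚ ((b ℤ.* b ℤ.^ (n ∸ d)) ℤ.* b ℤ.^ d) ℚ.* f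
      ≡⟨ cong (ℚ._* f) (ℤtoℚ-* (b ℤ.* b ℤ.^ (n ∸ d)) (b ℤ.^ d)) ⟩
    ℤtoℚ (b ℤ.* b ℤ.^ (n ∸ d)) ℚ.* ℤtoℚ (b ℤ.^ d) ℚ.* f
      ≡⟨ ℚ.*-assoc (ℤtoℚ (b ℤ.* b ℤ.^ (n ∸ d))) (ℤtoℚ (b ℤ.^ d)) f ⟩
    ℤtoℚ (b ℤ.* b ℤ.^ (n ∸ d)) ℚ.* (ℤtoℚ (b ℤ.^ d) ℚ.* f)
      ≡⟨ cong (ℤtoℚ (b ℤ.* b ℤ.^ (n ∸ d)) ℚ.*_) bᵈf≡ ⟩
    ℤtoℚ (b ℤ.* b ℤ.^ (n ∸ d)) ℚ.* ℤtoℚ (a ℤ.^ d ℤ.+ b ℤ.* w)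
      ≡⟨ ℤtoℚ-* (b ℤ.* b ℤ.^ (n ∸ d)) (a ℤ.^ d ℤ.+ b ℤ.* w) ⟨
    ℤtoℚ ((b ℤ.* b ℤ.^ (n ∸ d)) ℤ.* (a ℤ.^ d ℤ.+ b ℤ.* w))
      ≡⟨ cong ℤtoℚ (ℤ.*-assoc b (b ℤ.^ (n ∸ d)) (a ℤ.^ d ℤ.+ b ℤ.* w)) ⟩
    ℤtoℚ (b ℤ.* (b ℤ.^ (n ∸ d) ℤ.* (a ℤ.^ d ℤ.+ b ℤ.* w)))
      ∎)
    where
    split-power : b ℤ.^ suc n ≡ (b ℤ.* b ℤ.^ (n ∸ d)) ℤ.* b ℤ.^ d
    split-power = begin
      b ℤ.* b ℤ.^ n                        ≡⟨ cong (λ m → b ℤ.* b ℤ.^ m) (ℕ.m∸n+n≡m d≤n) ⟨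
      b ℤ.* b ℤ.^ (n ∸ d + d)              ≡⟨ cong (b ℤ.*_) (ℤ.^-distribˡ-+-* b (n ∸ d) d) ⟩
      b ℤ.* (b ℤ.^ (n ∸ d) ℤ.* b ℤ.^ d)    ≡⟨ ℤ.*-assoc b (b ℤ.^ (n ∸ d)) (b ℤ.^ d) ⟨
      (b ℤ.* b ℤ.^ (n ∸ d)) ℤ.* b ℤ.^ d    ∎

  lowDegree-0 : ∀ {n} → LowDegreeValue n 0ℚ
  lowDegree-0 {n} = 0ℤ , trans (ℚ.*-zeroʳ (ℤtoℚ (b ℤ.^ n))) (cong ℤtoℚ (sym (ℤ.*-zeroʳ b)))

  lowDegree-+ : ∀ {n f g} → LowDegreeValue n f → LowDegreeValue n g → LowDegreeValue n (f ℚ.+ g)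
  lowDegree-+ {n} {f} {g} (w₁ , bⁿf≡) (w₂ , bⁿg≡) = w₁ ℤ.+ w₂ , (begin
    ℤtoℚ (b ℤ.^ n) ℚ.* (f ℚ.+ g)                      ≡⟨ ℚ.*-distribˡ-+ (ℤtoℚ (b ℤ.^ n)) f g ⟩
    ℤtoℚ (b ℤ.^ n) ℚ.* f ℚ.+ ℤtoℚ (b ℤ.^ n) ℚ.* g     ≡⟨ cong₂ ℚ._+_ bⁿf≡ bⁿg≡ ⟩
    ℤtoℚ (b ℤ.* w₁) ℚ.+ ℤtoℚ (b ℤ.* w₂)               ≡⟨ ℤtoℚ-+ (b ℤ.* w₁) (b ℤ.* w₂) ⟨
    ℤtoℚ (b ℤ.* w₁ ℤ.+ b ℤ.* w₂)                      ≡⟨ cong ℤtoℚ (ℤ.*-distribˡ-+ b w₁ w₂) ⟨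
    ℤtoℚ (b ℤ.* (w₁ ℤ.+ w₂))                          ∎)

  monic-+ : ∀ {n f g} → MonicValue n f → LowDegreeValue n g → MonicValue n (f ℚ.+ g)
  monic-+ {n} {f} {g} (w₁ , bⁿf≡) (w₂ , bⁿg≡) = w₁ ℤ.+ w₂ , (begin
    ℤtoℚ (b ℤ.^ n) ℚ.* (f ℚ.+ g)                             ≡⟨ ℚ.*-distribˡ-+ (ℤtoℚ (b ℤ.^ n)) f g ⟩
    ℤtoℚ (b ℤ.^ n) ℚ.* f ℚ.+ ℤtoℚ (b ℤ.^ n) ℚ.* g            ≡⟨ cong₂ ℚ._+_ bⁿf≡ bⁿg≡ ⟩
    ℤtoℚ (a ℤ.^ n ℤ.+ b ℤ.* w₁) ℚ.+ ℤtoℚ (b ℤ.* w₂)          ≡⟨ ℤtoℚ-+ (a ℤ.^ n ℤ.+ b ℤ.* w₁) (b ℤ.* w₂) ⟨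
    ℤtoℚ (a ℤ.^ n ℤ.+ b ℤ.* w₁ ℤ.+ b ℤ.* w₂)                 ≡⟨ cong ℤtoℚ (regroup (a ℤ.^ n) b w₁ w₂) ⟩
    ℤtoℚ (a ℤ.^ n ℤ.+ b ℤ.* (w₁ ℤ.+ w₂))                     ∎)
    where
    regroup : ∀ P b w₁ w₂ → P ℤ.+ b ℤ.* w₁ ℤ.+ b ℤ.* w₂ ≡ P ℤ.+ b ℤ.* (w₁ ℤ.+ w₂)
    regroup = ℤ-Solver.solve-∀

  lowDegree-∑ : ∀ {n} {xs : List A} {f : A → ℚ} → All (λ x → LowDegreeValue n (f x)) xs → LowDegreeValue n (∑ℚ xs f)
  lowDegree-∑ {n = n} []         = lowDegree-0 {n}
  lowDegree-∑ {n = n} (fx ∷ fxs) = lowDegree-+ {n} fx (lowDegree-∑ {n = n} fxs)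

  monic-root⇒integer : ∀ {n} → MonicValue n 0ℚ → ∃ λ z → q ≡ ℤtoℚ z
  monic-root⇒integer {n} (w , bⁿ0≡) = a , denominator≡1⇒integer q (coprime-∣^⇒≡1 n (denominator-coprime q) b∣aⁿ)
    where
    0≡aⁿ+bw : 0ℤ ≡ a ℤ.^ n ℤ.+ b ℤ.* w
    0≡aⁿ+bw = ℤtoℚ-injective (trans (sym (ℚ.*-zeroʳ (ℤtoℚ (b ℤ.^ n)))) bⁿ0≡)
    aⁿ≡-bw : a ℤ.^ n ≡ ℤ.- (b ℤ.* w)
    aⁿ≡-bw = begin
      a ℤ.^ n                                   ≡⟨ add-sub (a ℤ.^ n) (b ℤ.* w) ⟩
      a ℤ.^ n ℤ.+ b ℤ.* w ℤ.- b ℤ.* w           ≡⟨ cong (ℤ._- b ℤ.* w) 0≡aⁿ+bw ⟨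
      0ℤ ℤ.- b ℤ.* w                            ≡⟨ ℤ.+-identityˡ (ℤ.- (b ℤ.* w)) ⟩
      ℤ.- (b ℤ.* w)                             ∎
      where
      add-sub : ∀ P X → P ≡ P ℤ.+ X ℤ.- X
      add-sub = ℤ-Solver.solve-∀
    b∣aⁿ : ↧ₙ q ∣ ℤ.∣ a ∣ ℕ.^ n
    b∣aⁿ = divides ℤ.∣ w ∣ (begin
      ℤ.∣ a ∣ ℕ.^ n           ≡⟨ ∣i^n∣≡∣i∣^n a n ⟨
      ℤ.∣ a ℤ.^ n ∣           ≡⟨ cong ℤ.∣_∣ aⁿ≡-bw ⟩
      ℤ.∣ ℤ.- (b ℤ.* w) ∣     ≡⟨ ℤ.∣-i∣≡∣i∣ (b ℤ.* w) ⟩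
      ℤ.∣ b ℤ.* w ∣           ≡⟨ ℤ.abs-* b w ⟩
      ↧ₙ q * ℤ.∣ w ∣          ≡⟨ ℕ.*-comm (↧ₙ q) ℤ.∣ w ∣ ⟩
      ℤ.∣ w ∣ * ↧ₙ q          ∎)

  chromaticValue-monic : (G : TwoEdgeColouredGraph n) → MonicValue n (evalPoly (chromaticPoly G) q)
  chromaticValue-monic {n} G
    rewrite evalPoly-chromaticPoly G q | partitions≡discrete∷nonDiscrete n | admissible-discrete G
    = monic-+ {n} (fallingℚ-monic n)
                  (lowDegree-∑ {n = n} (All.map (λ {e} → term-lowDegree {e}) (nonDiscrete-fewer-blocks n)))
    where
    term-lowDegree : ∀ {(d , P) : Σ ℕ (Partition n)} → d < n →
                     LowDegreeValue n (if admissible G P then fallingℚ q d else 0ℚ)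
    term-lowDegree {d , P} d<n with admissible G P
    ... | true  = monic⇒lowDegree d<n (fallingℚ-monic d)
    ... | false = lowDegree-0 {n}

chromaticRoot⇒integer : (G : TwoEdgeColouredGraph n) (p : List ℚ) → IsChromaticPoly G p →
                        ∀ q → evalPoly p q ≡ 0ℚ → ∃ λ z → q ≡ ℤtoℚ z
chromaticRoot⇒integer {n} G p p-chromatic q p[q]≡0 =
  monic-root⇒integer {n} (subst (MonicValue n) chromatic[q]≡0 (chromaticValue-monic G))
  where
  open RationalRoot q
  chromatic[q]≡0 : evalPoly (chromaticPoly G) q ≡ 0ℚ
  chromatic[q]≡0 = trans (sym (agree-on-ℕ⇒agree p (chromaticPoly G) p≗chromatic q)) p[q]≡0
    where
    p≗chromatic : ∀ k → evalPoly p (ℕtoℚ k) ≡ evalPoly (chromaticPoly G) (ℕtoℚ k)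
    p≗chromatic k = trans (p-chromatic k) (sym (chromaticPoly-isChromatic G k))

-- A red edge next to a blue clique

module RedEdgeBlueClique (m : ℕ) where
  edgeᴳ : Fin (2 + m) → Fin (2 + m) → EdgeC
  edgeᴳ zero          (suc zero)    = red
  edgeᴳ (suc zero)    zero          = red
  edgeᴳ (suc (suc s)) (suc (suc t)) = if s == t then none else blue
  edgeᴳ _             _             = none

  symmᴳ : ∀ u v → edgeᴳ u v ≡ edgeᴳ v u
  symmᴳ zero          zero          = refl
  symmᴳ zero          (suc zero)    = refl
  symmᴳ zero          (suc (suc t)) = refl
  symmᴳ (suc zero)    zero          = refl
  symmᴳ (suc zero)    (suc zero)    = refl
  symmᴳ (suc zero)    (suc (suc t)) = refl
  symmᴳ (suc (suc s)) zero          = refl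
  symmᴳ (suc (suc s)) (suc zero)    = refl
  symmᴳ (suc (suc s)) (suc (suc t)) = cong (if_then none else blue) (==-sym s t)

  looplessᴳ : ∀ u → edgeᴳ u u ≡ none
  looplessᴳ zero          = refl
  looplessᴳ (suc zero)    = refl
  looplessᴳ (suc (suc s)) = cong (if_then none else blue) (==-refl s)

  graph : TwoEdgeColouredGraph (2 + m)
  graph = record { edge = edgeᴳ ; symm = symmᴳ ; loopless = looplessᴳ }

  blue-edge : ∀ {s t} → s ≢ t → edgeᴳ (suc (suc s)) (suc (suc t)) ≡ blue
  blue-edge s≢t = cong (if_then none else blue) (≢⇒== s≢t)

  red-edge⁻ : ∀ u x → edgeᴳ u x ≡ red → (u ≡ zero × x ≡ suc zero) ⊎ (u ≡ suc zero × x ≡ zero)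
  red-edge⁻ zero          (suc zero)    _  = inj₁ (refl , refl)
  red-edge⁻ (suc zero)    zero          _  = inj₂ (refl , refl)
  red-edge⁻ zero          zero          ()
  red-edge⁻ zero          (suc (suc t)) ()
  red-edge⁻ (suc zero)    (suc zero)    ()
  red-edge⁻ (suc zero)    (suc (suc t)) ()
  red-edge⁻ (suc (suc s)) zero          ()
  red-edge⁻ (suc (suc s)) (suc zero)    ()
  red-edge⁻ (suc (suc s)) (suc (suc t)) st with s == t
  ... | true  with () ← st
  ... | false with () ← st

  blue-edge⁻ : ∀ u x → edgeᴳ u x ≡ blue → ∃ λ s → ∃ λ t → u ≡ suc (suc s) × x ≡ suc (suc t)
  blue-edge⁻ (suc (suc s)) (suc (suc t)) _  = s , t , refl , refl
  blue-edge⁻ zero          zero          ()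
  blue-edge⁻ zero          (suc zero)    ()
  blue-edge⁻ zero          (suc (suc t)) ()
  blue-edge⁻ (suc zero)    zero          ()
  blue-edge⁻ (suc zero)    (suc zero)    ()
  blue-edge⁻ (suc zero)    (suc (suc t)) ()
  blue-edge⁻ (suc (suc s)) zero          ()
  blue-edge⁻ (suc (suc s)) (suc zero)    ()

  module _ (i j : Fin k) (v : Vec (Fin k) m) where
    private
      c : Vec (Fin k) (2 + m)
      c = i ∷ j ∷ v

    IsColouring⇒condition : IsColouring graph c → (distinct v ∧ (not (i == j) ∧ (fresh v i ∨ fresh v j))) ≡ true
    IsColouring⇒condition is-colouring = cong₂ _∧_ distinct-v (cong₂ _∧_ (cong not (≢⇒== i≢j)) one-fresh)
      where
      open IsColouring is-colouring
      i≢j : i ≢ j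
      i≢j = proper zero (suc zero) refl
      clique-injective : ∀ s t → lookup v s ≡ lookup v t → s ≡ t
      clique-injective s t vs≡vt with s ≟ t
      ... | yes s≡t = s≡t
      ... | no  s≢t = ⊥-elim (proper (suc (suc s)) (suc (suc t)) (cong isEdge (blue-edge s≢t)) vs≡vt)
      distinct-v : distinct v ≡ true
      distinct-v = injective⇒distinct v clique-injective
      one-fresh : (fresh v i ∨ fresh v j) ≡ true
      one-fresh with fresh v i in fresh-i | fresh v j in fresh-j
      ... | true  | _     = refl
      ... | false | true  = refl
      ... | false | false with fresh-false⇒occurs v fresh-i | fresh-false⇒occurs v fresh-j
      ... | s , i≡vs | t , j≡vt with s ≟ t
      ... | yes refl = ⊥-elim (i≢j (trans i≡vs (sym j≡vt)))
      ... | no  s≢t  = ⊥-elim (compatible zero (suc zero) (suc (suc s)) (suc (suc t)) refl (blue-edge s≢t) i≡vs j≡vt)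

    condition⇒IsColouring : (distinct v ∧ (not (i == j) ∧ (fresh v i ∨ fresh v j))) ≡ true → IsColouring graph c
    condition⇒IsColouring condition = record { proper = proper ; compatible = compatible }
      where
      distinct-v : distinct v ≡ true
      distinct-v = proj₁ (∧≡true⁻ condition)
      i≠j : not (i == j) ≡ true
      i≠j = proj₁ (∧≡true⁻ (proj₂ (∧≡true⁻ {distinct v} condition)))
      one-fresh : (fresh v i ∨ fresh v j) ≡ true
      one-fresh = proj₂ (∧≡true⁻ {not (i == j)} (proj₂ (∧≡true⁻ {distinct v} condition)))
      i≢j : i ≢ j
      i≢j i≡j with () ← trans (sym i≠j) (cong not (≡⇒== i≡j))
      proper : ∀ u x → isEdge (edgeᴳ u x) ≡ true → lookup c u ≢ lookup c x
      proper zero          (suc zero)    _  = i≢j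
      proper (suc zero)    zero          _  = i≢j ∘ sym
      proper (suc (suc s)) (suc (suc t)) st with s == t in s==t
      proper (suc (suc s)) (suc (suc t)) () | true
      proper (suc (suc s)) (suc (suc t)) _  | false = λ vs≡vt →
        case trans (sym s==t) (≡⇒== (lookup-injective v distinct-v s t vs≡vt)) of λ ()
      proper zero          zero          ()
      proper zero          (suc (suc t)) ()
      proper (suc zero)    (suc zero)    ()
      proper (suc zero)    (suc (suc t)) ()
      proper (suc (suc s)) zero          ()
      proper (suc (suc s)) (suc zero)    ()
      both-occur : ∀ s t → i ≡ lookup v s → j ≡ lookup v t → ⊥
      both-occur s t i≡vs j≡vt = case trans (sym one-fresh) (cong₂ _∨_ (stale i≡vs) (stale j≡vt)) of λ ()
        where
        stale : ∀ {x b} → x ≡ lookup v b → fresh v x ≡ false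
        stale {b = b} refl = fresh-lookup v b
      compatible : ∀ u x w y → edgeᴳ u x ≡ red → edgeᴳ w y ≡ blue → lookup c u ≡ lookup c w → lookup c x ≢ lookup c y
      compatible u x w y ux wy with red-edge⁻ u x ux | blue-edge⁻ w y wy
      ... | inj₁ (refl , refl) | s , t , refl , refl = both-occur s t
      ... | inj₂ (refl , refl) | s , t , refl , refl = λ j≡vs i≡vt → both-occur t s i≡vt j≡vs

    isColouring-graph : isColouring graph c ≡ (distinct v ∧ (not (i == j) ∧ (fresh v i ∨ fresh v j)))
    isColouring-graph = bool-ext (IsColouring⇒condition ∘ isColouring⇒IsColouring graph c)
                                 (IsColouring⇒isColouring graph c ∘ condition⇒IsColouring)

  numColourings-graph : ∀ k → numColourings graph k ≡ (k P′ m) * ((k ∸ m) * (k ∸ 1) + m * (k ∸ m))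
  numColourings-graph k = begin
    numColourings graph k
      ≡⟨ numColourings≡∑ graph k ⟩
    ∑[ c ← allMaps (2 + m) k ] ind (isColouring graph c) 1
      ≡⟨ trans (∑-allMaps-suc {k = k} (λ c → ind (isColouring graph c) 1))
               (∑-cong (allFin k) λ i → ∑-allMaps-suc {k = k} (λ v → ind (isColouring graph (i ∷ v)) 1)) ⟩
    ∑[ i ← allFin k ] ∑[ j ← allFin k ] ∑[ v ← allMaps m k ] ind (isColouring graph (i ∷ j ∷ v)) 1
      ≡⟨ ∑-cong (allFin k) (λ i → ∑-cong (allFin k) λ j → ∑-cong (allMaps m k) λ v →
           trans (cong (λ b → ind b 1) (isColouring-graph i j v)) (if-∧ (distinct v))) ⟩
    ∑[ i ← allFin k ] ∑[ j ← allFin k ] ∑[ v ← allMaps m k ] ind (distinct v) (Pair v i j)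
      ≡⟨ ∑-cong (allFin k) (λ i → ∑-comm (allFin k) (allMaps m k) _) ⟩
    ∑[ i ← allFin k ] ∑[ v ← allMaps m k ] ∑[ j ← allFin k ] ind (distinct v) (Pair v i j)
      ≡⟨ ∑-comm (allFin k) (allMaps m k) _ ⟩
    ∑[ v ← allMaps m k ] ∑[ i ← allFin k ] ∑[ j ← allFin k ] ind (distinct v) (Pair v i j)
      ≡⟨ ∑-cong (allMaps m k) (λ v → trans (∑-cong (allFin k) λ i → ∑-ind (allFin k) (distinct v) (Pair v i))
                                           (∑-ind (allFin k) (distinct v) (Pairs v))) ⟩
    ∑[ v ← allMaps m k ] ind (distinct v) (∑ (allFin k) (Pairs v))
      ≡⟨ ∑-filterᵇ distinct (allMaps m k) _ ⟨
    ∑[ v ← injections m k ] ∑ (allFin k) (Pairs v)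
      ≡⟨ ∑-cong-All (All.map (λ {v} → count-pairs-not-both-in v) (injections-distinct m k)) ⟩
    ∑[ v ← injections m k ] ((k ∸ m) * (k ∸ 1) + m * (k ∸ m))
      ≡⟨ ∑-const (injections m k) _ ⟩
    length (injections m k) * ((k ∸ m) * (k ∸ 1) + m * (k ∸ m))
      ≡⟨ cong (_* ((k ∸ m) * (k ∸ 1) + m * (k ∸ m))) (length-injections m k) ⟩
    (k P′ m) * ((k ∸ m) * (k ∸ 1) + m * (k ∸ m))
      ∎
    where
    Pair : Vec (Fin k) m → Fin k → Fin k → ℕ
    Pair v i j = ind (not (i == j) ∧ (fresh v i ∨ fresh v j)) 1
    Pairs : Vec (Fin k) m → Fin k → ℕ
    Pairs v i = ∑ (allFin k) (Pair v i)

  graphPoly : List ℚ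
  graphPoly = mulLinear (ℚ.- ℕtoℚ m) (mulLinear (ℕtoℚ m ℚ.- 1ℚ) (fallingPoly m))

  evalPoly-graphPoly : ∀ x → evalPoly graphPoly x ≡ (x ℚ.- ℕtoℚ m) ℚ.* ((x ℚ.+ (ℕtoℚ m ℚ.- 1ℚ)) ℚ.* fallingℚ x m)
  evalPoly-graphPoly x =
    trans (evalPoly-mulLinear (ℚ.- ℕtoℚ m) (mulLinear (ℕtoℚ m ℚ.- 1ℚ) (fallingPoly m)) x)
          (cong ((x ℚ.- ℕtoℚ m) ℚ.*_) (trans (evalPoly-mulLinear (ℕtoℚ m ℚ.- 1ℚ) (fallingPoly m) x)
                                             (cong ((x ℚ.+ (ℕtoℚ m ℚ.- 1ℚ)) ℚ.*_) (evalPoly-fallingPoly m x))))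

  evalPoly-graphPoly-below : ∀ {k} → k < m → evalPoly graphPoly (ℕtoℚ k) ≡ 0ℚ
  evalPoly-graphPoly-below {k} k<m = begin
    evalPoly graphPoly K
      ≡⟨ evalPoly-graphPoly K ⟩
    (K ℚ.- M) ℚ.* ((K ℚ.+ (M ℚ.- 1ℚ)) ℚ.* fallingℚ K m)
      ≡⟨ cong (λ x → (K ℚ.- M) ℚ.* ((K ℚ.+ (M ℚ.- 1ℚ)) ℚ.* x)) (fallingℚ-vanishes k<m) ⟩
    (K ℚ.- M) ℚ.* ((K ℚ.+ (M ℚ.- 1ℚ)) ℚ.* 0ℚ)
      ≡⟨ annihilate (K ℚ.- M) (K ℚ.+ (M ℚ.- 1ℚ)) ⟩
    0ℚ
      ∎
    where
    K M : ℚ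
    K = ℕtoℚ k
    M = ℕtoℚ m
    annihilate : ∀ x y → x ℚ.* (y ℚ.* 0ℚ) ≡ 0ℚ
    annihilate = solve-∀ ℚ-ring

  numColourings-graph-below : ∀ {k} → k < m → numColourings graph k ≡ 0
  numColourings-graph-below {k} k<m =
    trans (numColourings-graph k) (cong (_* ((k ∸ m) * (k ∸ 1) + m * (k ∸ m))) (P′-vanishes k<m))

  ℕtoℚ-pairs : ∀ {k} → 1 ≤ m → m ≤ k →
    ℕtoℚ ((k ∸ m) * (k ∸ 1) + m * (k ∸ m)) ≡ (ℕtoℚ k ℚ.- ℕtoℚ m) ℚ.* (ℕtoℚ k ℚ.- 1ℚ) ℚ.+ ℕtoℚ m ℚ.* (ℕtoℚ k ℚ.- ℕtoℚ m)
  ℕtoℚ-pairs {k} 1≤m m≤k = begin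
    ℕtoℚ ((k ∸ m) * (k ∸ 1) + m * (k ∸ m))
      ≡⟨ ℕtoℚ-+ ((k ∸ m) * (k ∸ 1)) (m * (k ∸ m)) ⟩
    ℕtoℚ ((k ∸ m) * (k ∸ 1)) ℚ.+ ℕtoℚ (m * (k ∸ m))
      ≡⟨ cong₂ ℚ._+_ (ℕtoℚ-* (k ∸ m) (k ∸ 1)) (ℕtoℚ-* m (k ∸ m)) ⟩
    ℕtoℚ (k ∸ m) ℚ.* ℕtoℚ (k ∸ 1) ℚ.+ ℕtoℚ m ℚ.* ℕtoℚ (k ∸ m)
      ≡⟨ cong₂ (λ x y → x ℚ.* y ℚ.+ ℕtoℚ m ℚ.* x) (ℕtoℚ-∸ m≤k) (ℕtoℚ-∸ (ℕ.≤-trans 1≤m m≤k)) ⟩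
    (ℕtoℚ k ℚ.- ℕtoℚ m) ℚ.* (ℕtoℚ k ℚ.- 1ℚ) ℚ.+ ℕtoℚ m ℚ.* (ℕtoℚ k ℚ.- ℕtoℚ m)
      ∎

  graphPoly-agrees-above : ∀ {k} → 1 ≤ m → m ≤ k → evalPoly graphPoly (ℕtoℚ k) ≡ ℕtoℚ (numColourings graph k)
  graphPoly-agrees-above {k} 1≤m m≤k = begin
    evalPoly graphPoly K
      ≡⟨ evalPoly-graphPoly K ⟩
    (K ℚ.- M) ℚ.* ((K ℚ.+ (M ℚ.- 1ℚ)) ℚ.* fallingℚ K m)
      ≡⟨ factorise (fallingℚ K m) K M ⟨
    fallingℚ K m ℚ.* ((K ℚ.- M) ℚ.* (K ℚ.- 1ℚ) ℚ.+ M ℚ.* (K ℚ.- M))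
      ≡⟨ cong₂ ℚ._*_ (ℕtoℚ-P′ k m) (ℕtoℚ-pairs 1≤m m≤k) ⟨
    ℕtoℚ (k P′ m) ℚ.* ℕtoℚ ((k ∸ m) * (k ∸ 1) + m * (k ∸ m))
      ≡⟨ ℕtoℚ-* (k P′ m) ((k ∸ m) * (k ∸ 1) + m * (k ∸ m)) ⟨
    ℕtoℚ ((k P′ m) * ((k ∸ m) * (k ∸ 1) + m * (k ∸ m)))
      ≡⟨ cong ℕtoℚ (numColourings-graph k) ⟨
    ℕtoℚ (numColourings graph k)
      ∎
    where
    K M : ℚ
    K = ℕtoℚ k
    M = ℕtoℚ m
    factorise : ∀ F K M → F ℚ.* ((K ℚ.- M) ℚ.* (K ℚ.- 1ℚ) ℚ.+ M ℚ.* (K ℚ.- M)) ≡ (K ℚ.- M) ℚ.* ((K ℚ.+ (M ℚ.- 1ℚ)) ℚ.* F)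
    factorise = solve-∀ ℚ-ring

  graphPoly-isChromatic : 1 ≤ m → IsChromaticPoly graph graphPoly
  graphPoly-isChromatic 1≤m k = [ graphPoly-agrees-above 1≤m , graphPoly-agrees-below ]′ (ℕ.≤-<-connex m k)
    where
    graphPoly-agrees-below : k < m → evalPoly graphPoly (ℕtoℚ k) ≡ ℕtoℚ (numColourings graph k)
    graphPoly-agrees-below k<m = trans (evalPoly-graphPoly-below k<m) (cong ℕtoℚ (sym (numColourings-graph-below k<m)))

module _ (t : ℕ) where
  open RedEdgeBlueClique (2 + t)

  graph-bichromatic : Bichromatic graph
  graph-bichromatic = (zero , suc zero , refl) , (suc (suc zero) , suc (suc (suc zero)) , refl)

  graphPoly-root-nonneg : evalPoly graphPoly (ℤtoℚ (ℤ.+ t)) ≡ 0ℚ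
  graphPoly-root-nonneg = evalPoly-graphPoly-below (ℕ.≤-trans (ℕ.n<1+n t) (ℕ.n≤1+n (suc t)))

  graphPoly-root-neg : evalPoly graphPoly (ℤtoℚ ℤ.-[1+ t ]) ≡ 0ℚ
  graphPoly-root-neg = begin
    evalPoly graphPoly X
      ≡⟨ evalPoly-graphPoly X ⟩
    (X ℚ.- M) ℚ.* ((X ℚ.+ (M ℚ.- 1ℚ)) ℚ.* fallingℚ X (2 + t))
      ≡⟨ cong (λ y → (X ℚ.- M) ℚ.* (y ℚ.* fallingℚ X (2 + t))) x+m-1≡0 ⟩
    (X ℚ.- M) ℚ.* (0ℚ ℚ.* fallingℚ X (2 + t))
      ≡⟨ annihilate (X ℚ.- M) (fallingℚ X (2 + t)) ⟩
    0ℚ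
      ∎
    where
    X M : ℚ
    X = ℤtoℚ ℤ.-[1+ t ]
    M = ℕtoℚ (2 + t)
    annihilate : ∀ x y → x ℚ.* (0ℚ ℚ.* y) ≡ 0ℚ
    annihilate = solve-∀ ℚ-ring
    cancel : ∀ s → ℚ.- s ℚ.+ ((s ℚ.+ 1ℚ) ℚ.- 1ℚ) ≡ 0ℚ
    cancel = solve-∀ ℚ-ring
    x+m-1≡0 : X ℚ.+ (M ℚ.- 1ℚ) ≡ 0ℚ
    x+m-1≡0 = trans (cong₂ (λ u w → u ℚ.+ (w ℚ.- 1ℚ)) (ℤtoℚ-neg (ℤ.+ suc t)) (ℕtoℚ-suc (suc t))) (cancel (ℕtoℚ (suc t)))

integer⇒rationalBichromaticRoot : ∀ z → RationalBichromaticRoot (ℤtoℚ z)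
integer⇒rationalBichromaticRoot (ℤ.+ t) =
  4 + t , graph , graph-bichromatic t , graphPoly , graphPoly-isChromatic (ℕ.s≤s ℕ.z≤n) , graphPoly-root-nonneg t
  where open RedEdgeBlueClique (2 + t)
integer⇒rationalBichromaticRoot ℤ.-[1+ t ] =
  4 + t , graph , graph-bichromatic t , graphPoly , graphPoly-isChromatic (ℕ.s≤s ℕ.z≤n) , graphPoly-root-neg t
  where open RedEdgeBlueClique (2 + t)

theorem16 : ∀ (q : ℚ) → (RationalBichromaticRoot q → ∃ λ (z : ℤ) → q ≡ ℤtoℚ z)
                       × ((∃ λ (z : ℤ) → q ≡ ℤtoℚ z) → RationalBichromaticRoot q)
theorem16 q = (λ (n , G , _ , p , p-chromatic , p[q]≡0) → chromaticRoot⇒integer G p p-chromatic q p[q]≡0)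
            , (λ (z , q≡z) → subst RationalBichromaticRoot (sym q≡z) (integer⇒rationalBichromaticRoot z))
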